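{- $\alpha_2=24/7$.
   Context: $\mathsf{3\text{ - }MAJ}_k:\{0,1\}^{3^k}\to\{0,1\}$ is recursive majority-of-three on the complete ternary tree $T_k$ (leaves $1,\dots,3^k$ left to right; $\mathsf{3\text{ - }MAJ}_0$ is the identity). Hard inputs: $\mathcal{H}_0=\{0,1\}$; for $h>0$, $\mathcal{H}_h$ is the set of $(x,y,z)\in\mathcal{H}_{h-1}^3$ with $\mathsf{3\text{ - }MAJ}_{h-1}(x),\mathsf{3\text{ - }MAJ}_{h-1}(y),\mathsf{3\text{ - }MAJ}_{h-1}(z)$ not all equal; $\mathcal{H}^0_h=\{x\in\mathcal{H}_h:\mathsf{3\text{ - }MAJ}_h(x)=0\}$. For $x\in\mathcal{H}_h$, the minority path starts at the root and repeatedly goes to the child whose value differs from its parent's; its leaf is the absolute minority $m(x)$. Encoding: let $\mathcal{R}=\{0,1\}\times\{1,2,3\}$ and $c(y,(b,1))=(y,b,1-b)$, $c(y,(b,2))=(1-b,y,b)$, $c(y,(b,3))=(b,1-b,y)$. Let $\mathcal{R}^{(1)}_h=\mathcal{R}^{3^{h-1}}$, $\mathcal{R}^{(k)}_h=\mathcal{R}^{(k-1)}_h\times\mathcal{R}^{3^{h-k}}$. For $y\in\mathcal{H}_{h-1}$, $r\in\mathcal{R}^{(1)}_h$, $\psi^{(1)}(y,r)=x$ with $(x_{3i-2},x_{3i-1},x_{3i})=c(y_i,r_i)$; for $k>1$, $y\in\mathcal{H}_{h-k}$, $(R,r)\in\mathcal{R}^{(k)}_h$: $\psi^{(k)}(y,(R,r))=\psi^{(k-1)}(\psi^{(1)}(y,r),R)$.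 With $\psi=\psi^{(k)}:\{0,1\}\times\mathcal{R}^{(k)}_k\to\mathcal{H}_k$, let $q_1(r)$ be the unique index with $\psi(y,r)_{q_1(r)}=y$ for both $y\in\{0,1\}$. For a deterministic decision tree $C$ on $3^k$ variables querying at least one variable, \[ \alpha_C=\frac{\Pr_{x\in_R\mathcal{H}^0_k,\ (y,r)\in_R\psi^{ -1}(x)}[C(x)\text{ queries }x_{q_1(r)}]}{\Pr_{x\in_R\mathcal{H}^0_k}[C(x)\text{ queries }x_{m(x)}]}, \] and $\alpha_k=\max_C\alpha_C$ over all such $C$. Here $k=2$. -}

module Defs where

open import Data.Bool using (Bool; true; false; not; _∧_; _∨_; if_then_else_; T?)
open import Data.Nat using (ℕ; zero; suc; _+_; _*_; _^_)
open import Data.Fin using (Fin; zero; suc; _↑ˡ_; _↑ʳ_)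
open import Data.Vec using (Vec; []; _∷_; splitAt; lookup; _++_)
open import Data.List using (List; []; _∷_; filter; length; concatMap; map; foldr; allFin)
open import Data.Product using (_×_; _,_; proj₁; proj₂)
open import Data.Integer using (+_)
open import Data.Rational using (ℚ; 0ℚ; _/_; _÷_; _≟_; ≢-nonZero)
  renaming (_+_ to _+ℚ_; _*_ to _*ℚ_)
open import Relation.Nullary using (yes; no)
open import Relation.Nullary.Decidable using (⌊_⌋)
open import Relation.Unary using (Decidable)
open import Relation.Binary.PropositionalEquality using (_≡_; refl)

maj3 : Bool → Bool → Bool → Bool
maj3 a b c = (a ∧ b) ∨ (b ∧ c) ∨ (a ∧ c)

_==_ : Bool → Bool → Bool
true  == true  = true
false == false = true
_     == _     = false

vecEq : ∀ {n} → Vec Bool n → Vec Bool n → Bool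
vecEq []       []       = true
vecEq (a ∷ as) (b ∷ bs) = (a == b) ∧ vecEq as bs

-- Note 3 ^ suc h reduces to 3^h + (3^h + (3^h + 0)); leaves are in
-- left-to-right order, so the i-th child gets the i-th block of 3^h leaves.

unpad : ∀ {A : Set} {n} → Vec A (n + 0) → Vec A n
unpad {n = zero}  []       = []
unpad {n = suc n} (x ∷ xs) = x ∷ unpad xs

split3 : ∀ {A : Set} h → Vec A (3 ^ suc h) →
         Vec A (3 ^ h) × Vec A (3 ^ h) × Vec A (3 ^ h)
split3 h v with splitAt (3 ^ h) v
... | a , rest , _ with splitAt (3 ^ h) rest
... | b , c , _ = a , b , unpad c

MAJ : ∀ h → Vec Bool (3 ^ h) → Bool
MAJ zero    (b ∷ []) = b
MAJ (suc h) v with split3 h v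
... | a , b , c = maj3 (MAJ h a) (MAJ h b) (MAJ h c)

isHard : ∀ h → Vec Bool (3 ^ h) → Bool
isHard zero    _ = true
isHard (suc h) v with split3 h v
... | a , b , c =
  isHard h a ∧ isHard h b ∧ isHard h c ∧
  not ((MAJ h a == MAJ h b) ∧ (MAJ h b == MAJ h c))

-- absolute minority m(x): follow the child whose value differs from the
-- parent's value (only meaningful on hard inputs)
minority : ∀ h → Vec Bool (3 ^ h) → Fin (3 ^ h)
minority zero    _ = zero
minority (suc h) v with split3 h v
... | a , b , c =
  let p = maj3 (MAJ h a) (MAJ h b) (MAJ h c) in
  if not (MAJ h a == p) then minority h a ↑ˡ (3 ^ h + (3 ^ h + 0))
  else if not (MAJ h b == p) then 3 ^ h ↑ʳ (minority h b ↑ˡ (3 ^ h + 0))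
  else 3 ^ h ↑ʳ (3 ^ h ↑ʳ (minority h c ↑ˡ 0))

-- Encoding.  R = {0,1} × {1,2,3}; the index j ∈ {1,2,3} is Fin 3
-- (zero ↦ 1, suc zero ↦ 2, suc (suc zero) ↦ 3).

ℛ : Set
ℛ = Bool × Fin 3

c : Bool → ℛ → Vec Bool 3
c y (b , zero)           = y ∷ b ∷ not b ∷ []
c y (b , suc zero)       = not b ∷ y ∷ b ∷ []
c y (b , suc (suc zero)) = b ∷ not b ∷ y ∷ []

ψ₁ : ∀ {n} → Vec Bool n → Vec ℛ n → Vec Bool (n * 3)
ψ₁ []       []       = []
ψ₁ (y ∷ ys) (r ∷ rs) = c y r ++ ψ₁ ys rs

-- ℛ^(2)_2 = ℛ^(1)_2 × ℛ^(3^0) = ℛ^3 × ℛ^1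
ℛ22 : Set
ℛ22 = Vec ℛ 3 × Vec ℛ 1

-- ψ = ψ^(2)(y,(R,r)) = ψ^(1)(ψ^(1)(y,r),R) : {0,1} × ℛ^(2)_2 → H_2
ψ : Bool → ℛ22 → Vec Bool 9
ψ y (R , r) = ψ₁ (ψ₁ (y ∷ []) r) R

allBool : List Bool
allBool = false ∷ true ∷ []

allVec : ∀ {A : Set} → List A → ∀ n → List (Vec A n)
allVec xs zero    = [] ∷ []
allVec xs (suc n) = concatMap (λ a → map (a ∷_) (allVec xs n)) xs

allℛ : List ℛ
allℛ = concatMap (λ b → map (b ,_) (allFin 3)) allBool

allℛ22 : List ℛ22
allℛ22 = concatMap (λ R → map (R ,_) (allVec allℛ 1)) (allVec allℛ 3)

allYR : List (Bool × ℛ22)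
allYR = concatMap (λ y → map (y ,_) allℛ22) allBool

count : ∀ {A : Set} → (A → Bool) → List A → ℕ
count p xs = length (filter (λ a → T? (p a)) xs)

-- first index satisfying a predicate (default zero if none)
firstFin : ∀ {n} → (Fin (suc n) → Bool) → Fin (suc n)
firstFin {zero}  p = zero
firstFin {suc n} p = if p zero then zero else suc (firstFin (λ i → p (suc i)))

-- q₁(r): the (unique) index with ψ(y,r)_{q₁(r)} = y for both y ∈ {0,1}
q₁ : ℛ22 → Fin 9
q₁ r = firstFin (λ i → (lookup (ψ false r) i == false) ∧ (lookup (ψ true r) i == true))

H⁰₂ : List (Vec Bool 9)
H⁰₂ = filter (λ x → T? (isHard 2 x ∧ not (MAJ 2 x))) (allVec allBool 9)

preimage : Vec Bool 9 → List (Bool × ℛ22)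
preimage x = filter (λ yr → T? (vecEq (ψ (proj₁ yr) (proj₂ yr)) x)) allYR

-- Deterministic decision trees on n variables: a leaf outputs a bit;
-- an internal node queries x_i and continues in the left subtree if
-- x_i = 0 and in the right subtree if x_i = 1.

data DTree (n : ℕ) : Set where
  leaf  : Bool → DTree n
  query : Fin n → DTree n → DTree n → DTree n

QueriesSome : ∀ {n} → DTree n → Set
QueriesSome (leaf _)      = Data.Empty.⊥ where import Data.Empty
QueriesSome (query _ _ _) = Data.Unit.⊤ where import Data.Unit

finEq : ∀ {n} → Fin n → Fin n → Bool
finEq zero    zero    = true
finEq (suc i) (suc j) = finEq i j
finEq _       _       = false

queries : ∀ {n} → DTree n → Vec Bool n → Fin n → Bool
queries (leaf _)      x j = false
queries (query i l r) x j =
  finEq i j ∨ (if lookup x i then queries r x j else queries l x j)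

frac : ℕ → ℕ → ℚ
frac a zero    = 0ℚ
frac a (suc d) = + a / suc d

sumℚ : List ℚ → ℚ
sumℚ = foldr _+ℚ_ 0ℚ

-- division; the convention p / 0 = 0 is never used (the denominator
-- of α_C is positive for every tree querying some variable)
divℚ : ℚ → ℚ → ℚ
divℚ p q with q ≟ 0ℚ
... | yes _  = 0ℚ
... | no q≢0 = _÷_ p q {{≢-nonZero q≢0}}

numer : DTree 9 → ℚ
numer C = sumℚ (map (λ x → frac 1 (length H⁰₂) *ℚ
                  frac (count (λ yr → queries C x (q₁ (proj₂ yr))) (preimage x))
                       (length (preimage x)))
                H⁰₂)

denom : DTree 9 → ℚ
denom C = frac (count (λ x → queries C x (minority 2 x)) H⁰₂) (length H⁰₂)

α : DTree 9 → ℚ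
α C = divℚ (numer C) (denom C)

module Submission where

-- Each x ∈ H⁰₂ (there are 81) has exactly 16 preimages (y , r) under ψ. With N C the number
-- of pairs (x , (y , r)) for which C(x) queries x_{q₁(r)}, and D C the number of x for which
-- C(x) queries the absolute minority m(x), this gives α C = (N/1296)/(D/81) = N/(16 D), so
-- α C ≤ 24/7 says 7 N − 384 D ≤ 0 for every decision tree C.
--
-- Run from a restriction ρ, the tree query i l r hands the inputs agreeing with ρ to l on
-- ρ[i ↦ 0] and to r on ρ[i ↦ 1], so the contribution of these inputs to 7 N − 384 D adds up
-- along the tree. Hence any Φ with (value of a leaf at ρ) ≤ Φ ρ and
-- Φ (ρ[i ↦ 0]) + Φ (ρ[i ↦ 1]) ≤ Φ ρ for every free i bounds every tree. Such a Φ with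
-- Φ ∅ = 0 is an explicit table, checked by evaluation and completed by a trivial bound where
-- it has no entry. A tree with N = 768 and D = 14 attains α = 24/7.

open import Defs
open import Data.Bool using (Bool; true; false; _∧_; _∨_; if_then_else_; T?)
import Data.Bool.Properties as Boolₚ
open import Data.Fin using (Fin; zero; suc; #_)
import Data.Fin.Properties as Finₚ
open import Data.Integer as ℤ using (ℤ; +_; -_; 0ℤ; _+_; _-_; _*_)
import Data.Integer.Properties as ℤₚ
open import Data.Integer.Tactic.RingSolver using (solve-∀)
open import Data.List using (List; []; _∷_; map; length; foldr)
import Data.List.Properties as Listₚ
open import Data.List.Relation.Unary.All as All using (All; []; _∷_; all?)
open import Data.Maybe using (Maybe; just; nothing; is-just; maybe′)
import Data.Maybe.Properties as Maybeₚ
open import Data.Nat as ℕ using (ℕ; zero; suc)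
import Data.Nat.Properties as ℕₚ
open import Data.Nat.ListAction using (sum)
import Data.Nat.Tactic.RingSolver as ℕ-Solver
open import Data.Product using (Σ; _×_; _,_; proj₂)
open import Data.Rational as ℚ using (ℚ; 0ℚ; _≤_; _/_)
import Data.Rational.Properties as ℚₚ
open import Data.Rational.Unnormalised as ℚᵘ using (mkℚᵘ; *≡*; *≤*)
import Data.Rational.Unnormalised.Properties as ℚᵘₚ
open import Data.Sum using (_⊎_; inj₁; inj₂)
open import Data.Vec using (Vec; []; _∷_; lookup; replicate; _[_]≔_)
import Data.Vec.Properties as Vecₚ
open import Function using (_∘_; id; Equivalence)
open import Relation.Nullary using (yes; no)
open import Relation.Nullary.Decidable using (Dec; isYes; _×-dec_; _→-dec_; toWitness)
open import Relation.Unary using (Decidable)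
open import Relation.Binary.PropositionalEquality
  using (_≡_; refl; sym; trans; cong; cong₂; subst; subst₂; module ≡-Reasoning)

count-map : ∀ {A B : Set} (p : B → Bool) (f : A → B) (xs : List A) →
            count p (map f xs) ≡ count (p ∘ f) xs
count-map p f []       = refl
count-map p f (x ∷ xs) with p (f x)
... | true  = cong suc (count-map p f xs)
... | false = count-map p f xs

count-cong : ∀ {A : Set} {p q : A → Bool} {xs : List A} →
             All (λ x → p x ≡ q x) xs → count p xs ≡ count q xs
count-cong []                                  = refl
count-cong {p = p} {q} {x ∷ _} (px≡qx ∷ eqs) with p x | q x
... | true  | true  = cong suc (count-cong eqs)
... | false | false = count-cong eqs
... | true  | false with () ← px≡qx
... | false | true  with () ← px≡qx

count≤length : ∀ {A : Set} (p : A → Bool) (xs : List A) → count p xs ℕ.≤ length xs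
count≤length p = Listₚ.length-filter (T? ∘ p)

if-cong-then : ∀ {A : Set} b {x y z : A} → (b ≡ true → x ≡ y) →
               (if b then x else z) ≡ (if b then y else z)
if-cong-then true  x≡y = x≡y refl
if-cong-then false _   = refl

sumℤ : List ℤ → ℤ
sumℤ = foldr _+_ 0ℤ

sumℤ-+ : ∀ {A : Set} (f g : A → ℤ) (xs : List A) →
         sumℤ (map (λ x → f x + g x) xs) ≡ sumℤ (map f xs) + sumℤ (map g xs)
sumℤ-+ f g []       = refl
sumℤ-+ f g (x ∷ xs) = begin
  (f x + g x) + sumℤ (map (λ x → f x + g x) xs)
    ≡⟨ cong (_+_ (f x + g x)) (sumℤ-+ f g xs) ⟩
  (f x + g x) + (sumℤ (map f xs) + sumℤ (map g xs))
    ≡⟨ interchange (f x) (g x) (sumℤ (map f xs)) (sumℤ (map g xs)) ⟩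
  (f x + sumℤ (map f xs)) + (g x + sumℤ (map g xs)) ∎
  where
  open ≡-Reasoning
  interchange : ∀ a b c d → (a + b) + (c + d) ≡ (a + c) + (b + d)
  interchange = solve-∀

sumℤ-mono-≤ : ∀ {A : Set} (f g : A → ℤ) (xs : List A) → (∀ x → f x ℤ.≤ g x) →
              sumℤ (map f xs) ℤ.≤ sumℤ (map g xs)
sumℤ-mono-≤ f g []       f≤g = ℤₚ.≤-refl
sumℤ-mono-≤ f g (x ∷ xs) f≤g = ℤₚ.+-mono-≤ (f≤g x) (sumℤ-mono-≤ f g xs f≤g)

frac-toℚᵘ : ∀ a d → ℚ.toℚᵘ (frac a (suc d)) ℚᵘ.≃ mkℚᵘ (+ a) d
frac-toℚᵘ a d = ℚₚ.toℚᵘ-fromℚᵘ (mkℚᵘ (+ a) d)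

frac-zero : ∀ d → frac 0 (suc d) ≡ 0ℚ
frac-zero d = ℚₚ.toℚᵘ-injective (ℚᵘₚ.≃-trans (frac-toℚᵘ 0 d) (*≡* refl))

frac-+ : ∀ a b d → frac a (suc d) ℚ.+ frac b (suc d) ≡ frac (a ℕ.+ b) (suc d)
frac-+ a b d = ℚₚ.toℚᵘ-injective (begin
  ℚ.toℚᵘ (frac a (suc d) ℚ.+ frac b (suc d))
    ≈⟨ ℚₚ.toℚᵘ-homo-+ (frac a (suc d)) (frac b (suc d)) ⟩
  ℚ.toℚᵘ (frac a (suc d)) ℚᵘ.+ ℚ.toℚᵘ (frac b (suc d))
    ≈⟨ ℚᵘₚ.+-cong (frac-toℚᵘ a d) (frac-toℚᵘ b d) ⟩
  mkℚᵘ (+ a) d ℚᵘ.+ mkℚᵘ (+ b) d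
    ≈⟨ *≡* (cross (+ a) (+ b) (+ suc d)) ⟩
  mkℚᵘ (+ a + + b) d
    ≈⟨ ℚᵘₚ.≃-sym (frac-toℚᵘ (a ℕ.+ b) d) ⟩
  ℚ.toℚᵘ (frac (a ℕ.+ b) (suc d)) ∎)
  where
  open ℚᵘₚ.≃-Reasoning
  cross : ∀ x y D → (x * D + y * D) * D ≡ (x + y) * (D * D)
  cross = solve-∀

frac-* : ∀ a b d e → frac a (suc d) ℚ.* frac b (suc e) ≡ frac (a ℕ.* b) (suc d ℕ.* suc e)
frac-* a b d e = ℚₚ.toℚᵘ-injective (begin
  ℚ.toℚᵘ (frac a (suc d) ℚ.* frac b (suc e))
    ≈⟨ ℚₚ.toℚᵘ-homo-* (frac a (suc d)) (frac b (suc e)) ⟩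
  ℚ.toℚᵘ (frac a (suc d)) ℚᵘ.* ℚ.toℚᵘ (frac b (suc e))
    ≈⟨ ℚᵘₚ.*-cong (frac-toℚᵘ a d) (frac-toℚᵘ b e) ⟩
  mkℚᵘ (+ a) d ℚᵘ.* mkℚᵘ (+ b) e
    ≈⟨ *≡* (cong₂ _*_ (sym (ℤₚ.pos-* a b)) (ℤₚ.pos-* (suc d) (suc e))) ⟩
  mkℚᵘ (+ (a ℕ.* b)) (ℕ.pred (suc d ℕ.* suc e))
    ≈⟨ ℚᵘₚ.≃-sym (frac-toℚᵘ (a ℕ.* b) (ℕ.pred (suc d ℕ.* suc e))) ⟩
  ℚ.toℚᵘ (frac (a ℕ.* b) (suc d ℕ.* suc e)) ∎)
  where open ℚᵘₚ.≃-Reasoning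

frac-mono-≤ : ∀ {a b d e} → a ℕ.* suc e ℕ.≤ b ℕ.* suc d → frac a (suc d) ≤ frac b (suc e)
frac-mono-≤ {a} {b} {d} {e} ae≤bd = ℚₚ.toℚᵘ-cancel-≤ (begin
  ℚ.toℚᵘ (frac a (suc d))  ≃⟨ frac-toℚᵘ a d ⟩
  mkℚᵘ (+ a) d             ≤⟨ *≤* cross ⟩
  mkℚᵘ (+ b) e             ≃⟨ ℚᵘₚ.≃-sym (frac-toℚᵘ b e) ⟩
  ℚ.toℚᵘ (frac b (suc e))  ∎)
  where
  open ℚᵘₚ.≤-Reasoning
  cross : + a * + suc e ℤ.≤ + b * + suc d
  cross = subst₂ ℤ._≤_ (ℤₚ.pos-* a (suc e)) (ℤₚ.pos-* b (suc d)) (ℤ.+≤+ ae≤bd)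

frac-nonNeg : ∀ a d → 0ℚ ≤ frac a (suc d)
frac-nonNeg a d = subst (_≤ frac a (suc d)) (frac-zero d) (frac-mono-≤ {0} {a} {d} {d} ℕ.z≤n)

divℚ-≤ : ∀ {p q r} → 0ℚ ≤ r → 0ℚ ≤ q → p ≤ r ℚ.* q → divℚ p q ≤ r
divℚ-≤ {p} {q} {r} 0≤r 0≤q p≤rq with q ℚ.≟ 0ℚ
... | yes _   = 0≤r
... | no q≢0 = begin
  p ℚ.* q⁻¹          ≤⟨ ℚₚ.*-monoʳ-≤-nonNeg q⁻¹ {{q⁻¹-nonNeg}} p≤rq ⟩
  r ℚ.* q ℚ.* q⁻¹    ≡⟨ ℚₚ.*-assoc r q q⁻¹ ⟩
  r ℚ.* (q ℚ.* q⁻¹)  ≡⟨ cong (r ℚ.*_) (ℚₚ.*-inverseʳ q {{q-nonZero}}) ⟩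
  r ℚ.* ℚ.1ℚ         ≡⟨ ℚₚ.*-identityʳ r ⟩
  r                  ∎
  where
  open ℚₚ.≤-Reasoning
  q-nonZero : ℚ.NonZero q
  q-nonZero = ℚ.≢-nonZero q≢0
  q⁻¹ : ℚ
  q⁻¹ = ℚ.1/_ q {{q-nonZero}}
  q⁻¹-nonNeg : ℚ.NonNegative q⁻¹
  q⁻¹-nonNeg = ℚₚ.pos⇒nonNeg q⁻¹
    {{ℚₚ.1/pos⇒pos q {{ℚₚ.nonNeg∧nonZero⇒pos q {{ℚ.nonNegative 0≤q}} {{q-nonZero}}}}}}

-- Restrictions (partial assignments)

Restriction : ℕ → Set
Restriction n = Vec (Maybe Bool) n

unrestricted : ∀ n → Restriction n
unrestricted n = replicate n nothing

isFixed : ∀ {n} → Restriction n → Fin n → Bool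
isFixed ρ j = is-just (lookup ρ j)

fix : ∀ {n} → Restriction n → Fin n → Bool → Restriction n
fix ρ i b = ρ [ i ]≔ just b

agrees : ∀ {n} → Restriction n → Vec Bool n → Bool
agrees []            []      = true
agrees (nothing ∷ ρ) (_ ∷ x) = agrees ρ x
agrees (just a ∷ ρ)  (b ∷ x) = (a == b) ∧ agrees ρ x

==-sound : ∀ {a b} → (a == b) ≡ true → a ≡ b
==-sound {true}  {true}  _ = refl
==-sound {false} {false} _ = refl

finEq-sound : ∀ {n} {i j : Fin n} → finEq i j ≡ true → i ≡ j
finEq-sound {i = zero}  {zero}  _  = refl
finEq-sound {i = suc i} {suc j} eq = cong suc (finEq-sound eq)

agrees-unrestricted : ∀ {n} (x : Vec Bool n) → agrees (unrestricted n) x ≡ true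
agrees-unrestricted []      = refl
agrees-unrestricted (_ ∷ x) = agrees-unrestricted x

isFixed-unrestricted : ∀ {n} (j : Fin n) → isFixed (unrestricted n) j ≡ false
isFixed-unrestricted j = cong is-just (Vecₚ.lookup-replicate j nothing)

isFixed-fix : ∀ {n} (ρ : Restriction n) i b j → isFixed (fix ρ i b) j ≡ isFixed ρ j ∨ finEq i j
isFixed-fix (m ∷ ρ) zero    b zero    = sym (Boolₚ.∨-zeroʳ (is-just m))
isFixed-fix (m ∷ ρ) zero    b (suc j) = sym (Boolₚ.∨-identityʳ (isFixed ρ j))
isFixed-fix (m ∷ ρ) (suc i) b zero    = sym (Boolₚ.∨-identityʳ (is-just m))
isFixed-fix (m ∷ ρ) (suc i) b (suc j) = isFixed-fix ρ i b j

agrees-fix : ∀ {n} (ρ : Restriction n) i b x → lookup ρ i ≡ nothing →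
             agrees (fix ρ i b) x ≡ (b == lookup x i) ∧ agrees ρ x
agrees-fix (nothing ∷ ρ) zero    b (y ∷ x) _    = refl
agrees-fix (nothing ∷ ρ) (suc i) b (y ∷ x) free = agrees-fix ρ i b x free
agrees-fix (just a ∷ ρ)  (suc i) b (y ∷ x) free
  rewrite agrees-fix ρ i b x free with a == y | b == lookup x i
... | true  | _     = refl
... | false | true  = refl
... | false | false = refl

agrees-lookup : ∀ {n} (ρ : Restriction n) i {b} x → lookup ρ i ≡ just b →
                agrees ρ x ≡ true → lookup x i ≡ b
agrees-lookup (just a ∷ ρ)  zero    (y ∷ x) refl ag = sym (==-sound (Boolₚ.∧-conicalˡ (a == y) _ ag))
agrees-lookup (nothing ∷ ρ) (suc i) (y ∷ x) eq   ag = agrees-lookup ρ i x eq ag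
agrees-lookup (just a ∷ ρ)  (suc i) (y ∷ x) eq   ag = agrees-lookup ρ i x eq (Boolₚ.∧-conicalʳ (a == y) _ ag)

data Table : ℕ → Set where
  stored : ℤ → Table 0
  absent : ∀ {n} → Table n
  node   : ∀ {n} → (free fixed₀ fixed₁ : Table n) → Table (suc n)

find : ∀ {n} → Table n → Restriction n → Maybe ℤ
find (stored v)   []               = just v
find absent       _                = nothing
find (node t _ _) (nothing ∷ ρ)    = find t ρ
find (node _ t _) (just false ∷ ρ) = find t ρ
find (node _ _ t) (just true ∷ ρ)  = find t ρ

allFound : ∀ {n} → (Restriction n → ℤ → Bool) → Table n → Bool
allFound P (stored v)   = P [] v
allFound P absent       = true
allFound P (node t₀ t₁ t₂) =
  allFound (P ∘ (nothing ∷_)) t₀ ∧ allFound (P ∘ (just false ∷_)) t₁ ∧ allFound (P ∘ (just true ∷_)) t₂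

allFound-sound : ∀ {n} P (t : Table n) → allFound P t ≡ true →
                 ∀ {ρ v} → find t ρ ≡ just v → P ρ v ≡ true
allFound-sound P (stored _) all {[]} refl = all
allFound-sound P (node t₀ t₁ t₂) all {m ∷ ρ} {v} = below m
  where
  P₀ P₁ P₂ : Restriction _ → ℤ → Bool
  P₀ = P ∘ (nothing ∷_)
  P₁ = P ∘ (just false ∷_)
  P₂ = P ∘ (just true ∷_)
  all₁₂ : allFound P₁ t₁ ∧ allFound P₂ t₂ ≡ true
  all₁₂ = Boolₚ.∧-conicalʳ (allFound P₀ t₀) _ all
  below : ∀ m → find (node t₀ t₁ t₂) (m ∷ ρ) ≡ just v → P (m ∷ ρ) v ≡ true
  below nothing      = allFound-sound P₀ t₀ (Boolₚ.∧-conicalˡ _ _ all)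
  below (just false) = allFound-sound P₁ t₁ (Boolₚ.∧-conicalˡ _ _ all₁₂)
  below (just true)  = allFound-sound P₂ t₂ (Boolₚ.∧-conicalʳ (allFound P₁ t₁) _ all₁₂)

-- Decision trees run from a restriction

module TreeValue {n : ℕ} {E : Set}
  (input : E → Vec Bool n)
  (score : E → (Fin n → Bool) → ℤ)
  (score-cong : ∀ e {S S′} → (∀ j → S j ≡ S′ j) → score e S ≡ score e S′)
  (entries : List E)
  where

  known : Restriction n → DTree n → Vec Bool n → Fin n → Bool
  known ρ C x j = isFixed ρ j ∨ queries C x j

  gain : DTree n → Restriction n → E → ℤ
  gain C ρ e = if agrees ρ (input e) then score e (known ρ C (input e)) else 0ℤ

  value : DTree n → Restriction n → ℤ
  value C ρ = sumℤ (map (gain C ρ) entries)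

  known-query : ∀ ρ i l r x j →
    known ρ (query i l r) x j ≡ known (fix ρ i (lookup x i)) (if lookup x i then r else l) x j
  known-query ρ i l r x j = begin
    isFixed ρ j ∨ (finEq i j ∨ (if b then queries r x j else queries l x j))
      ≡⟨ sym (Boolₚ.∨-assoc (isFixed ρ j) (finEq i j) _) ⟩
    (isFixed ρ j ∨ finEq i j) ∨ (if b then queries r x j else queries l x j)
      ≡⟨ cong₂ _∨_ (sym (isFixed-fix ρ i b j)) (sym (Boolₚ.if-float (λ C → queries C x j) b)) ⟩
    isFixed (fix ρ i b) j ∨ queries (if b then r else l) x j ∎
    where
    open ≡-Reasoning
    b : Bool
    b = lookup x i

  gain-query-free : ∀ ρ i l r e → lookup ρ i ≡ nothing →
    gain (query i l r) ρ e ≡ gain l (fix ρ i false) e + gain r (fix ρ i true) e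
  gain-query-free ρ i l r e free = begin
    gain (query i l r) ρ e
      ≡⟨ if-cong-then (agrees ρ x) (λ _ → score-cong e (known-query ρ i l r x)) ⟩
    (if agrees ρ x then branch (lookup x i) else 0ℤ)
      ≡⟨ split (agrees ρ x) (lookup x i) ⟩
    (if (false == lookup x i) ∧ agrees ρ x then branch false else 0ℤ)
      + (if (true == lookup x i) ∧ agrees ρ x then branch true else 0ℤ)
      ≡⟨ sym (cong₂ _+_ (cong (λ a → if a then branch false else 0ℤ) (agrees-fix ρ i false x free))
                        (cong (λ a → if a then branch true else 0ℤ) (agrees-fix ρ i true x free))) ⟩
    gain l (fix ρ i false) e + gain r (fix ρ i true) e ∎
    where
    open ≡-Reasoning
    x : Vec Bool n
    x = input e
    branch : Bool → ℤ
    branch b = score e (known (fix ρ i b) (if b then r else l) x)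
    split : ∀ a b → (if a then branch b else 0ℤ) ≡
      (if (false == b) ∧ a then branch false else 0ℤ) + (if (true == b) ∧ a then branch true else 0ℤ)
    split false false = refl
    split false true  = refl
    split true  false = sym (ℤₚ.+-identityʳ (branch false))
    split true  true  = sym (ℤₚ.+-identityˡ (branch true))

  gain-query-fixed : ∀ ρ i {b} l r e → lookup ρ i ≡ just b →
    gain (query i l r) ρ e ≡ gain (if b then r else l) ρ e
  gain-query-fixed ρ i {b} l r e ρi≡b = if-cong-then (agrees ρ x) λ agree →
    score-cong e λ j → begin
      known ρ (query i l r) x j
        ≡⟨ known-query ρ i l r x j ⟩
      known (fix ρ i (lookup x i)) (if lookup x i then r else l) x j
        ≡⟨ cong (λ c → known (fix ρ i c) (if c then r else l) x j) (agrees-lookup ρ i x ρi≡b agree) ⟩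
      known (fix ρ i b) (if b then r else l) x j
        ≡⟨ cong (λ σ → known σ (if b then r else l) x j) fix-fixed ⟩
      known ρ (if b then r else l) x j ∎
    where
    open ≡-Reasoning
    x : Vec Bool n
    x = input e
    fix-fixed : fix ρ i b ≡ ρ
    fix-fixed = trans (cong (ρ [ i ]≔_) (sym ρi≡b)) (Vecₚ.[]≔-lookup ρ i)

  value-query-free : ∀ ρ i l r → lookup ρ i ≡ nothing →
    value (query i l r) ρ ≡ value l (fix ρ i false) + value r (fix ρ i true)
  value-query-free ρ i l r free =
    trans (cong sumℤ (Listₚ.map-cong (λ e → gain-query-free ρ i l r e free) entries)) (sumℤ-+ _ _ entries)

  value-query-fixed : ∀ ρ i {b} l r → lookup ρ i ≡ just b →
    value (query i l r) ρ ≡ value (if b then r else l) ρ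
  value-query-fixed ρ i l r ρi≡b =
    cong sumℤ (Listₚ.map-cong (λ e → gain-query-fixed ρ i l r e ρi≡b) entries)

  value-unrestricted : ∀ C → value C (unrestricted n) ≡ sumℤ (map (λ e → score e (queries C (input e))) entries)
  value-unrestricted C = cong sumℤ (Listₚ.map-cong gain-unrestricted entries)
    where
    gain-unrestricted : ∀ e → gain C (unrestricted n) e ≡ score e (queries C (input e))
    gain-unrestricted e = trans
      (cong (λ a → if a then score e (known (unrestricted n) C (input e)) else 0ℤ) (agrees-unrestricted (input e)))
      (score-cong e (λ j → cong (_∨ queries C (input e) j) (isFixed-unrestricted j)))

  LocalBound : (Restriction n → ℤ) → Restriction n → ℤ → Set
  LocalBound Φ ρ v = value (leaf false) ρ ℤ.≤ v
                   × (∀ i → lookup ρ i ≡ nothing → Φ (fix ρ i false) + Φ (fix ρ i true) ℤ.≤ v)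

  value≤potential : (Φ : Restriction n → ℤ) →
    (∀ ρ → (∀ C → value C ρ ℤ.≤ Φ ρ) ⊎ LocalBound Φ ρ (Φ ρ)) →
    ∀ C ρ → value C ρ ℤ.≤ Φ ρ
  value≤potential Φ bound (leaf b) ρ with bound ρ
  ... | inj₁ global     = global (leaf b)
  ... | inj₂ (leaf≤ , _) = leaf≤
  value≤potential Φ bound (query i l r) ρ with bound ρ
  ... | inj₁ global      = global (query i l r)
  ... | inj₂ (_ , split≤) with lookup ρ i in ρi
  ...   | just false = ℤₚ.≤-trans (ℤₚ.≤-reflexive (value-query-fixed ρ i l r ρi)) (value≤potential Φ bound l ρ)
  ...   | just true  = ℤₚ.≤-trans (ℤₚ.≤-reflexive (value-query-fixed ρ i l r ρi)) (value≤potential Φ bound r ρ)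
  ...   | nothing    = begin
    value (query i l r) ρ                             ≡⟨ value-query-free ρ i l r ρi ⟩
    value l (fix ρ i false) + value r (fix ρ i true)  ≤⟨ ℤₚ.+-mono-≤ (value≤potential Φ bound l _)
                                                                      (value≤potential Φ bound r _) ⟩
    Φ (fix ρ i false) + Φ (fix ρ i true)              ≤⟨ split≤ i ρi ⟩
    Φ ρ                                               ∎
    where open ℤₚ.≤-Reasoning

  value≤ceiling : (ceiling : Restriction n → E → ℤ) →
    (∀ ρ e Q → score e (λ j → isFixed ρ j ∨ Q j) ℤ.≤ ceiling ρ e) →
    ∀ C ρ → value C ρ ℤ.≤ sumℤ (map (λ e → if agrees ρ (input e) then ceiling ρ e else 0ℤ) entries)
  value≤ceiling ceiling score≤ C ρ =
    sumℤ-mono-≤ (gain C ρ) _ entries λ e → guarded (agrees ρ (input e)) (score≤ ρ e (queries C (input e)))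
    where
    guarded : ∀ a {s t} → s ℤ.≤ t → (if a then s else 0ℤ) ℤ.≤ (if a then t else 0ℤ)
    guarded true  s≤t = s≤t
    guarded false _   = ℤₚ.≤-refl

record Profile : Set where
  constructor profile
  field
    input        : Vec Bool 9
    targets      : List (Fin 9)
    minorityLeaf : Fin 9

open Profile

Faithful : Profile → Set
Faithful e = length (preimage (input e)) ≡ 16
           × map (q₁ ∘ proj₂) (preimage (input e)) ≡ targets e
           × minority 2 (input e) ≡ minorityLeaf e

faithful? : Decidable Faithful
faithful? e = (length (preimage (input e)) ℕ.≟ 16)
         ×-dec (Listₚ.≡-dec Finₚ._≟_ (map (q₁ ∘ proj₂) (preimage (input e))) (targets e))
         ×-dec (minority 2 (input e) Finₚ.≟ minorityLeaf e)

-- Precomputed so that evaluating the certificate never recomputes preimages under ψ.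
profiles : List Profile
profiles =
  profile (false ∷ false ∷ true ∷ false ∷ false ∷ true ∷ false ∷ true ∷ true ∷ []) (# 0 ∷ # 3 ∷ # 0 ∷ # 3 ∷ # 0 ∷ # 4 ∷ # 0 ∷ # 4 ∷ # 1 ∷ # 3 ∷ # 1 ∷ # 3 ∷ # 1 ∷ # 4 ∷ # 1 ∷ # 4 ∷ []) (# 6) ∷
  profile (false ∷ false ∷ true ∷ false ∷ false ∷ true ∷ true ∷ false ∷ true ∷ []) (# 0 ∷ # 3 ∷ # 0 ∷ # 3 ∷ # 0 ∷ # 4 ∷ # 0 ∷ # 4 ∷ # 1 ∷ # 3 ∷ # 1 ∷ # 3 ∷ # 1 ∷ # 4 ∷ # 1 ∷ # 4 ∷ []) (# 7) ∷
  profile (false ∷ false ∷ true ∷ false ∷ false ∷ true ∷ true ∷ true ∷ false ∷ []) (# 0 ∷ # 3 ∷ # 0 ∷ # 3 ∷ # 0 ∷ # 4 ∷ # 0 ∷ # 4 ∷ # 1 ∷ # 3 ∷ # 1 ∷ # 3 ∷ # 1 ∷ # 4 ∷ # 1 ∷ # 4 ∷ []) (# 8) ∷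
  profile (false ∷ false ∷ true ∷ false ∷ true ∷ false ∷ false ∷ true ∷ true ∷ []) (# 0 ∷ # 5 ∷ # 0 ∷ # 5 ∷ # 0 ∷ # 3 ∷ # 0 ∷ # 3 ∷ # 1 ∷ # 5 ∷ # 1 ∷ # 5 ∷ # 1 ∷ # 3 ∷ # 1 ∷ # 3 ∷ []) (# 6) ∷
  profile (false ∷ false ∷ true ∷ false ∷ true ∷ false ∷ true ∷ false ∷ true ∷ []) (# 0 ∷ # 5 ∷ # 0 ∷ # 5 ∷ # 0 ∷ # 3 ∷ # 0 ∷ # 3 ∷ # 1 ∷ # 5 ∷ # 1 ∷ # 5 ∷ # 1 ∷ # 3 ∷ # 1 ∷ # 3 ∷ []) (# 7) ∷
  profile (false ∷ false ∷ true ∷ false ∷ true ∷ false ∷ true ∷ true ∷ false ∷ []) (# 0 ∷ # 5 ∷ # 0 ∷ # 5 ∷ # 0 ∷ # 3 ∷ # 0 ∷ # 3 ∷ # 1 ∷ # 5 ∷ # 1 ∷ # 5 ∷ # 1 ∷ # 3 ∷ # 1 ∷ # 3 ∷ []) (# 8) ∷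
  profile (false ∷ false ∷ true ∷ false ∷ true ∷ true ∷ false ∷ false ∷ true ∷ []) (# 6 ∷ # 0 ∷ # 7 ∷ # 0 ∷ # 6 ∷ # 0 ∷ # 7 ∷ # 0 ∷ # 6 ∷ # 1 ∷ # 7 ∷ # 1 ∷ # 6 ∷ # 1 ∷ # 7 ∷ # 1 ∷ []) (# 3) ∷
  profile (false ∷ false ∷ true ∷ false ∷ true ∷ true ∷ false ∷ true ∷ false ∷ []) (# 8 ∷ # 0 ∷ # 6 ∷ # 0 ∷ # 8 ∷ # 0 ∷ # 6 ∷ # 0 ∷ # 8 ∷ # 1 ∷ # 6 ∷ # 1 ∷ # 8 ∷ # 1 ∷ # 6 ∷ # 1 ∷ []) (# 3) ∷
  profile (false ∷ false ∷ true ∷ false ∷ true ∷ true ∷ true ∷ false ∷ false ∷ []) (# 7 ∷ # 0 ∷ # 8 ∷ # 0 ∷ # 7 ∷ # 0 ∷ # 8 ∷ # 0 ∷ # 7 ∷ # 1 ∷ # 8 ∷ # 1 ∷ # 7 ∷ # 1 ∷ # 8 ∷ # 1 ∷ []) (# 3) ∷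
  profile (false ∷ false ∷ true ∷ true ∷ false ∷ false ∷ false ∷ true ∷ true ∷ []) (# 0 ∷ # 4 ∷ # 0 ∷ # 4 ∷ # 0 ∷ # 5 ∷ # 0 ∷ # 5 ∷ # 1 ∷ # 4 ∷ # 1 ∷ # 4 ∷ # 1 ∷ # 5 ∷ # 1 ∷ # 5 ∷ []) (# 6) ∷
  profile (false ∷ false ∷ true ∷ true ∷ false ∷ false ∷ true ∷ false ∷ true ∷ []) (# 0 ∷ # 4 ∷ # 0 ∷ # 4 ∷ # 0 ∷ # 5 ∷ # 0 ∷ # 5 ∷ # 1 ∷ # 4 ∷ # 1 ∷ # 4 ∷ # 1 ∷ # 5 ∷ # 1 ∷ # 5 ∷ []) (# 7) ∷
  profile (false ∷ false ∷ true ∷ true ∷ false ∷ false ∷ true ∷ true ∷ false ∷ []) (# 0 ∷ # 4 ∷ # 0 ∷ # 4 ∷ # 0 ∷ # 5 ∷ # 0 ∷ # 5 ∷ # 1 ∷ # 4 ∷ # 1 ∷ # 4 ∷ # 1 ∷ # 5 ∷ # 1 ∷ # 5 ∷ []) (# 8) ∷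
  profile (false ∷ false ∷ true ∷ true ∷ false ∷ true ∷ false ∷ false ∷ true ∷ []) (# 6 ∷ # 0 ∷ # 7 ∷ # 0 ∷ # 6 ∷ # 0 ∷ # 7 ∷ # 0 ∷ # 6 ∷ # 1 ∷ # 7 ∷ # 1 ∷ # 6 ∷ # 1 ∷ # 7 ∷ # 1 ∷ []) (# 4) ∷
  profile (false ∷ false ∷ true ∷ true ∷ false ∷ true ∷ false ∷ true ∷ false ∷ []) (# 8 ∷ # 0 ∷ # 6 ∷ # 0 ∷ # 8 ∷ # 0 ∷ # 6 ∷ # 0 ∷ # 8 ∷ # 1 ∷ # 6 ∷ # 1 ∷ # 8 ∷ # 1 ∷ # 6 ∷ # 1 ∷ []) (# 4) ∷
  profile (false ∷ false ∷ true ∷ true ∷ false ∷ true ∷ true ∷ false ∷ false ∷ []) (# 7 ∷ # 0 ∷ # 8 ∷ # 0 ∷ # 7 ∷ # 0 ∷ # 8 ∷ # 0 ∷ # 7 ∷ # 1 ∷ # 8 ∷ # 1 ∷ # 7 ∷ # 1 ∷ # 8 ∷ # 1 ∷ []) (# 4) ∷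
  profile (false ∷ false ∷ true ∷ true ∷ true ∷ false ∷ false ∷ false ∷ true ∷ []) (# 6 ∷ # 0 ∷ # 7 ∷ # 0 ∷ # 6 ∷ # 0 ∷ # 7 ∷ # 0 ∷ # 6 ∷ # 1 ∷ # 7 ∷ # 1 ∷ # 6 ∷ # 1 ∷ # 7 ∷ # 1 ∷ []) (# 5) ∷
  profile (false ∷ false ∷ true ∷ true ∷ true ∷ false ∷ false ∷ true ∷ false ∷ []) (# 8 ∷ # 0 ∷ # 6 ∷ # 0 ∷ # 8 ∷ # 0 ∷ # 6 ∷ # 0 ∷ # 8 ∷ # 1 ∷ # 6 ∷ # 1 ∷ # 8 ∷ # 1 ∷ # 6 ∷ # 1 ∷ []) (# 5) ∷
  profile (false ∷ false ∷ true ∷ true ∷ true ∷ false ∷ true ∷ false ∷ false ∷ []) (# 7 ∷ # 0 ∷ # 8 ∷ # 0 ∷ # 7 ∷ # 0 ∷ # 8 ∷ # 0 ∷ # 7 ∷ # 1 ∷ # 8 ∷ # 1 ∷ # 7 ∷ # 1 ∷ # 8 ∷ # 1 ∷ []) (# 5) ∷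
  profile (false ∷ true ∷ false ∷ false ∷ false ∷ true ∷ false ∷ true ∷ true ∷ []) (# 2 ∷ # 3 ∷ # 2 ∷ # 3 ∷ # 2 ∷ # 4 ∷ # 2 ∷ # 4 ∷ # 0 ∷ # 3 ∷ # 0 ∷ # 3 ∷ # 0 ∷ # 4 ∷ # 0 ∷ # 4 ∷ []) (# 6) ∷
  profile (false ∷ true ∷ false ∷ false ∷ false ∷ true ∷ true ∷ false ∷ true ∷ []) (# 2 ∷ # 3 ∷ # 2 ∷ # 3 ∷ # 2 ∷ # 4 ∷ # 2 ∷ # 4 ∷ # 0 ∷ # 3 ∷ # 0 ∷ # 3 ∷ # 0 ∷ # 4 ∷ # 0 ∷ # 4 ∷ []) (# 7) ∷
  profile (false ∷ true ∷ false ∷ false ∷ false ∷ true ∷ true ∷ true ∷ false ∷ []) (# 2 ∷ # 3 ∷ # 2 ∷ # 3 ∷ # 2 ∷ # 4 ∷ # 2 ∷ # 4 ∷ # 0 ∷ # 3 ∷ # 0 ∷ # 3 ∷ # 0 ∷ # 4 ∷ # 0 ∷ # 4 ∷ []) (# 8) ∷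
  profile (false ∷ true ∷ false ∷ false ∷ true ∷ false ∷ false ∷ true ∷ true ∷ []) (# 2 ∷ # 5 ∷ # 2 ∷ # 5 ∷ # 2 ∷ # 3 ∷ # 2 ∷ # 3 ∷ # 0 ∷ # 5 ∷ # 0 ∷ # 5 ∷ # 0 ∷ # 3 ∷ # 0 ∷ # 3 ∷ []) (# 6) ∷
  profile (false ∷ true ∷ false ∷ false ∷ true ∷ false ∷ true ∷ false ∷ true ∷ []) (# 2 ∷ # 5 ∷ # 2 ∷ # 5 ∷ # 2 ∷ # 3 ∷ # 2 ∷ # 3 ∷ # 0 ∷ # 5 ∷ # 0 ∷ # 5 ∷ # 0 ∷ # 3 ∷ # 0 ∷ # 3 ∷ []) (# 7) ∷
  profile (false ∷ true ∷ false ∷ false ∷ true ∷ false ∷ true ∷ true ∷ false ∷ []) (# 2 ∷ # 5 ∷ # 2 ∷ # 5 ∷ # 2 ∷ # 3 ∷ # 2 ∷ # 3 ∷ # 0 ∷ # 5 ∷ # 0 ∷ # 5 ∷ # 0 ∷ # 3 ∷ # 0 ∷ # 3 ∷ []) (# 8) ∷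
  profile (false ∷ true ∷ false ∷ false ∷ true ∷ true ∷ false ∷ false ∷ true ∷ []) (# 6 ∷ # 2 ∷ # 7 ∷ # 2 ∷ # 6 ∷ # 2 ∷ # 7 ∷ # 2 ∷ # 6 ∷ # 0 ∷ # 7 ∷ # 0 ∷ # 6 ∷ # 0 ∷ # 7 ∷ # 0 ∷ []) (# 3) ∷
  profile (false ∷ true ∷ false ∷ false ∷ true ∷ true ∷ false ∷ true ∷ false ∷ []) (# 8 ∷ # 2 ∷ # 6 ∷ # 2 ∷ # 8 ∷ # 2 ∷ # 6 ∷ # 2 ∷ # 8 ∷ # 0 ∷ # 6 ∷ # 0 ∷ # 8 ∷ # 0 ∷ # 6 ∷ # 0 ∷ []) (# 3) ∷
  profile (false ∷ true ∷ false ∷ false ∷ true ∷ true ∷ true ∷ false ∷ false ∷ []) (# 7 ∷ # 2 ∷ # 8 ∷ # 2 ∷ # 7 ∷ # 2 ∷ # 8 ∷ # 2 ∷ # 7 ∷ # 0 ∷ # 8 ∷ # 0 ∷ # 7 ∷ # 0 ∷ # 8 ∷ # 0 ∷ []) (# 3) ∷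
  profile (false ∷ true ∷ false ∷ true ∷ false ∷ false ∷ false ∷ true ∷ true ∷ []) (# 2 ∷ # 4 ∷ # 2 ∷ # 4 ∷ # 2 ∷ # 5 ∷ # 2 ∷ # 5 ∷ # 0 ∷ # 4 ∷ # 0 ∷ # 4 ∷ # 0 ∷ # 5 ∷ # 0 ∷ # 5 ∷ []) (# 6) ∷
  profile (false ∷ true ∷ false ∷ true ∷ false ∷ false ∷ true ∷ false ∷ true ∷ []) (# 2 ∷ # 4 ∷ # 2 ∷ # 4 ∷ # 2 ∷ # 5 ∷ # 2 ∷ # 5 ∷ # 0 ∷ # 4 ∷ # 0 ∷ # 4 ∷ # 0 ∷ # 5 ∷ # 0 ∷ # 5 ∷ []) (# 7) ∷
  profile (false ∷ true ∷ false ∷ true ∷ false ∷ false ∷ true ∷ true ∷ false ∷ []) (# 2 ∷ # 4 ∷ # 2 ∷ # 4 ∷ # 2 ∷ # 5 ∷ # 2 ∷ # 5 ∷ # 0 ∷ # 4 ∷ # 0 ∷ # 4 ∷ # 0 ∷ # 5 ∷ # 0 ∷ # 5 ∷ []) (# 8) ∷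
  profile (false ∷ true ∷ false ∷ true ∷ false ∷ true ∷ false ∷ false ∷ true ∷ []) (# 6 ∷ # 2 ∷ # 7 ∷ # 2 ∷ # 6 ∷ # 2 ∷ # 7 ∷ # 2 ∷ # 6 ∷ # 0 ∷ # 7 ∷ # 0 ∷ # 6 ∷ # 0 ∷ # 7 ∷ # 0 ∷ []) (# 4) ∷
  profile (false ∷ true ∷ false ∷ true ∷ false ∷ true ∷ false ∷ true ∷ false ∷ []) (# 8 ∷ # 2 ∷ # 6 ∷ # 2 ∷ # 8 ∷ # 2 ∷ # 6 ∷ # 2 ∷ # 8 ∷ # 0 ∷ # 6 ∷ # 0 ∷ # 8 ∷ # 0 ∷ # 6 ∷ # 0 ∷ []) (# 4) ∷
  profile (false ∷ true ∷ false ∷ true ∷ false ∷ true ∷ true ∷ false ∷ false ∷ []) (# 7 ∷ # 2 ∷ # 8 ∷ # 2 ∷ # 7 ∷ # 2 ∷ # 8 ∷ # 2 ∷ # 7 ∷ # 0 ∷ # 8 ∷ # 0 ∷ # 7 ∷ # 0 ∷ # 8 ∷ # 0 ∷ []) (# 4) ∷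
  profile (false ∷ true ∷ false ∷ true ∷ true ∷ false ∷ false ∷ false ∷ true ∷ []) (# 6 ∷ # 2 ∷ # 7 ∷ # 2 ∷ # 6 ∷ # 2 ∷ # 7 ∷ # 2 ∷ # 6 ∷ # 0 ∷ # 7 ∷ # 0 ∷ # 6 ∷ # 0 ∷ # 7 ∷ # 0 ∷ []) (# 5) ∷
  profile (false ∷ true ∷ false ∷ true ∷ true ∷ false ∷ false ∷ true ∷ false ∷ []) (# 8 ∷ # 2 ∷ # 6 ∷ # 2 ∷ # 8 ∷ # 2 ∷ # 6 ∷ # 2 ∷ # 8 ∷ # 0 ∷ # 6 ∷ # 0 ∷ # 8 ∷ # 0 ∷ # 6 ∷ # 0 ∷ []) (# 5) ∷
  profile (false ∷ true ∷ false ∷ true ∷ true ∷ false ∷ true ∷ false ∷ false ∷ []) (# 7 ∷ # 2 ∷ # 8 ∷ # 2 ∷ # 7 ∷ # 2 ∷ # 8 ∷ # 2 ∷ # 7 ∷ # 0 ∷ # 8 ∷ # 0 ∷ # 7 ∷ # 0 ∷ # 8 ∷ # 0 ∷ []) (# 5) ∷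
  profile (false ∷ true ∷ true ∷ false ∷ false ∷ true ∷ false ∷ false ∷ true ∷ []) (# 3 ∷ # 6 ∷ # 3 ∷ # 7 ∷ # 4 ∷ # 6 ∷ # 4 ∷ # 7 ∷ # 3 ∷ # 6 ∷ # 3 ∷ # 7 ∷ # 4 ∷ # 6 ∷ # 4 ∷ # 7 ∷ []) (# 0) ∷
  profile (false ∷ true ∷ true ∷ false ∷ false ∷ true ∷ false ∷ true ∷ false ∷ []) (# 3 ∷ # 8 ∷ # 3 ∷ # 6 ∷ # 4 ∷ # 8 ∷ # 4 ∷ # 6 ∷ # 3 ∷ # 8 ∷ # 3 ∷ # 6 ∷ # 4 ∷ # 8 ∷ # 4 ∷ # 6 ∷ []) (# 0) ∷
  profile (false ∷ true ∷ true ∷ false ∷ false ∷ true ∷ true ∷ false ∷ false ∷ []) (# 3 ∷ # 7 ∷ # 3 ∷ # 8 ∷ # 4 ∷ # 7 ∷ # 4 ∷ # 8 ∷ # 3 ∷ # 7 ∷ # 3 ∷ # 8 ∷ # 4 ∷ # 7 ∷ # 4 ∷ # 8 ∷ []) (# 0) ∷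
  profile (false ∷ true ∷ true ∷ false ∷ true ∷ false ∷ false ∷ false ∷ true ∷ []) (# 5 ∷ # 6 ∷ # 5 ∷ # 7 ∷ # 3 ∷ # 6 ∷ # 3 ∷ # 7 ∷ # 5 ∷ # 6 ∷ # 5 ∷ # 7 ∷ # 3 ∷ # 6 ∷ # 3 ∷ # 7 ∷ []) (# 0) ∷
  profile (false ∷ true ∷ true ∷ false ∷ true ∷ false ∷ false ∷ true ∷ false ∷ []) (# 5 ∷ # 8 ∷ # 5 ∷ # 6 ∷ # 3 ∷ # 8 ∷ # 3 ∷ # 6 ∷ # 5 ∷ # 8 ∷ # 5 ∷ # 6 ∷ # 3 ∷ # 8 ∷ # 3 ∷ # 6 ∷ []) (# 0) ∷
  profile (false ∷ true ∷ true ∷ false ∷ true ∷ false ∷ true ∷ false ∷ false ∷ []) (# 5 ∷ # 7 ∷ # 5 ∷ # 8 ∷ # 3 ∷ # 7 ∷ # 3 ∷ # 8 ∷ # 5 ∷ # 7 ∷ # 5 ∷ # 8 ∷ # 3 ∷ # 7 ∷ # 3 ∷ # 8 ∷ []) (# 0) ∷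
  profile (false ∷ true ∷ true ∷ true ∷ false ∷ false ∷ false ∷ false ∷ true ∷ []) (# 4 ∷ # 6 ∷ # 4 ∷ # 7 ∷ # 5 ∷ # 6 ∷ # 5 ∷ # 7 ∷ # 4 ∷ # 6 ∷ # 4 ∷ # 7 ∷ # 5 ∷ # 6 ∷ # 5 ∷ # 7 ∷ []) (# 0) ∷
  profile (false ∷ true ∷ true ∷ true ∷ false ∷ false ∷ false ∷ true ∷ false ∷ []) (# 4 ∷ # 8 ∷ # 4 ∷ # 6 ∷ # 5 ∷ # 8 ∷ # 5 ∷ # 6 ∷ # 4 ∷ # 8 ∷ # 4 ∷ # 6 ∷ # 5 ∷ # 8 ∷ # 5 ∷ # 6 ∷ []) (# 0) ∷
  profile (false ∷ true ∷ true ∷ true ∷ false ∷ false ∷ true ∷ false ∷ false ∷ []) (# 4 ∷ # 7 ∷ # 4 ∷ # 8 ∷ # 5 ∷ # 7 ∷ # 5 ∷ # 8 ∷ # 4 ∷ # 7 ∷ # 4 ∷ # 8 ∷ # 5 ∷ # 7 ∷ # 5 ∷ # 8 ∷ []) (# 0) ∷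
  profile (true ∷ false ∷ false ∷ false ∷ false ∷ true ∷ false ∷ true ∷ true ∷ []) (# 1 ∷ # 3 ∷ # 1 ∷ # 3 ∷ # 1 ∷ # 4 ∷ # 1 ∷ # 4 ∷ # 2 ∷ # 3 ∷ # 2 ∷ # 3 ∷ # 2 ∷ # 4 ∷ # 2 ∷ # 4 ∷ []) (# 6) ∷
  profile (true ∷ false ∷ false ∷ false ∷ false ∷ true ∷ true ∷ false ∷ true ∷ []) (# 1 ∷ # 3 ∷ # 1 ∷ # 3 ∷ # 1 ∷ # 4 ∷ # 1 ∷ # 4 ∷ # 2 ∷ # 3 ∷ # 2 ∷ # 3 ∷ # 2 ∷ # 4 ∷ # 2 ∷ # 4 ∷ []) (# 7) ∷
  profile (true ∷ false ∷ false ∷ false ∷ false ∷ true ∷ true ∷ true ∷ false ∷ []) (# 1 ∷ # 3 ∷ # 1 ∷ # 3 ∷ # 1 ∷ # 4 ∷ # 1 ∷ # 4 ∷ # 2 ∷ # 3 ∷ # 2 ∷ # 3 ∷ # 2 ∷ # 4 ∷ # 2 ∷ # 4 ∷ []) (# 8) ∷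
  profile (true ∷ false ∷ false ∷ false ∷ true ∷ false ∷ false ∷ true ∷ true ∷ []) (# 1 ∷ # 5 ∷ # 1 ∷ # 5 ∷ # 1 ∷ # 3 ∷ # 1 ∷ # 3 ∷ # 2 ∷ # 5 ∷ # 2 ∷ # 5 ∷ # 2 ∷ # 3 ∷ # 2 ∷ # 3 ∷ []) (# 6) ∷
  profile (true ∷ false ∷ false ∷ false ∷ true ∷ false ∷ true ∷ false ∷ true ∷ []) (# 1 ∷ # 5 ∷ # 1 ∷ # 5 ∷ # 1 ∷ # 3 ∷ # 1 ∷ # 3 ∷ # 2 ∷ # 5 ∷ # 2 ∷ # 5 ∷ # 2 ∷ # 3 ∷ # 2 ∷ # 3 ∷ []) (# 7) ∷
  profile (true ∷ false ∷ false ∷ false ∷ true ∷ false ∷ true ∷ true ∷ false ∷ []) (# 1 ∷ # 5 ∷ # 1 ∷ # 5 ∷ # 1 ∷ # 3 ∷ # 1 ∷ # 3 ∷ # 2 ∷ # 5 ∷ # 2 ∷ # 5 ∷ # 2 ∷ # 3 ∷ # 2 ∷ # 3 ∷ []) (# 8) ∷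
  profile (true ∷ false ∷ false ∷ false ∷ true ∷ true ∷ false ∷ false ∷ true ∷ []) (# 6 ∷ # 1 ∷ # 7 ∷ # 1 ∷ # 6 ∷ # 1 ∷ # 7 ∷ # 1 ∷ # 6 ∷ # 2 ∷ # 7 ∷ # 2 ∷ # 6 ∷ # 2 ∷ # 7 ∷ # 2 ∷ []) (# 3) ∷
  profile (true ∷ false ∷ false ∷ false ∷ true ∷ true ∷ false ∷ true ∷ false ∷ []) (# 8 ∷ # 1 ∷ # 6 ∷ # 1 ∷ # 8 ∷ # 1 ∷ # 6 ∷ # 1 ∷ # 8 ∷ # 2 ∷ # 6 ∷ # 2 ∷ # 8 ∷ # 2 ∷ # 6 ∷ # 2 ∷ []) (# 3) ∷
  profile (true ∷ false ∷ false ∷ false ∷ true ∷ true ∷ true ∷ false ∷ false ∷ []) (# 7 ∷ # 1 ∷ # 8 ∷ # 1 ∷ # 7 ∷ # 1 ∷ # 8 ∷ # 1 ∷ # 7 ∷ # 2 ∷ # 8 ∷ # 2 ∷ # 7 ∷ # 2 ∷ # 8 ∷ # 2 ∷ []) (# 3) ∷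
  profile (true ∷ false ∷ false ∷ true ∷ false ∷ false ∷ false ∷ true ∷ true ∷ []) (# 1 ∷ # 4 ∷ # 1 ∷ # 4 ∷ # 1 ∷ # 5 ∷ # 1 ∷ # 5 ∷ # 2 ∷ # 4 ∷ # 2 ∷ # 4 ∷ # 2 ∷ # 5 ∷ # 2 ∷ # 5 ∷ []) (# 6) ∷
  profile (true ∷ false ∷ false ∷ true ∷ false ∷ false ∷ true ∷ false ∷ true ∷ []) (# 1 ∷ # 4 ∷ # 1 ∷ # 4 ∷ # 1 ∷ # 5 ∷ # 1 ∷ # 5 ∷ # 2 ∷ # 4 ∷ # 2 ∷ # 4 ∷ # 2 ∷ # 5 ∷ # 2 ∷ # 5 ∷ []) (# 7) ∷
  profile (true ∷ false ∷ false ∷ true ∷ false ∷ false ∷ true ∷ true ∷ false ∷ []) (# 1 ∷ # 4 ∷ # 1 ∷ # 4 ∷ # 1 ∷ # 5 ∷ # 1 ∷ # 5 ∷ # 2 ∷ # 4 ∷ # 2 ∷ # 4 ∷ # 2 ∷ # 5 ∷ # 2 ∷ # 5 ∷ []) (# 8) ∷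
  profile (true ∷ false ∷ false ∷ true ∷ false ∷ true ∷ false ∷ false ∷ true ∷ []) (# 6 ∷ # 1 ∷ # 7 ∷ # 1 ∷ # 6 ∷ # 1 ∷ # 7 ∷ # 1 ∷ # 6 ∷ # 2 ∷ # 7 ∷ # 2 ∷ # 6 ∷ # 2 ∷ # 7 ∷ # 2 ∷ []) (# 4) ∷
  profile (true ∷ false ∷ false ∷ true ∷ false ∷ true ∷ false ∷ true ∷ false ∷ []) (# 8 ∷ # 1 ∷ # 6 ∷ # 1 ∷ # 8 ∷ # 1 ∷ # 6 ∷ # 1 ∷ # 8 ∷ # 2 ∷ # 6 ∷ # 2 ∷ # 8 ∷ # 2 ∷ # 6 ∷ # 2 ∷ []) (# 4) ∷
  profile (true ∷ false ∷ false ∷ true ∷ false ∷ true ∷ true ∷ false ∷ false ∷ []) (# 7 ∷ # 1 ∷ # 8 ∷ # 1 ∷ # 7 ∷ # 1 ∷ # 8 ∷ # 1 ∷ # 7 ∷ # 2 ∷ # 8 ∷ # 2 ∷ # 7 ∷ # 2 ∷ # 8 ∷ # 2 ∷ []) (# 4) ∷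
  profile (true ∷ false ∷ false ∷ true ∷ true ∷ false ∷ false ∷ false ∷ true ∷ []) (# 6 ∷ # 1 ∷ # 7 ∷ # 1 ∷ # 6 ∷ # 1 ∷ # 7 ∷ # 1 ∷ # 6 ∷ # 2 ∷ # 7 ∷ # 2 ∷ # 6 ∷ # 2 ∷ # 7 ∷ # 2 ∷ []) (# 5) ∷
  profile (true ∷ false ∷ false ∷ true ∷ true ∷ false ∷ false ∷ true ∷ false ∷ []) (# 8 ∷ # 1 ∷ # 6 ∷ # 1 ∷ # 8 ∷ # 1 ∷ # 6 ∷ # 1 ∷ # 8 ∷ # 2 ∷ # 6 ∷ # 2 ∷ # 8 ∷ # 2 ∷ # 6 ∷ # 2 ∷ []) (# 5) ∷
  profile (true ∷ false ∷ false ∷ true ∷ true ∷ false ∷ true ∷ false ∷ false ∷ []) (# 7 ∷ # 1 ∷ # 8 ∷ # 1 ∷ # 7 ∷ # 1 ∷ # 8 ∷ # 1 ∷ # 7 ∷ # 2 ∷ # 8 ∷ # 2 ∷ # 7 ∷ # 2 ∷ # 8 ∷ # 2 ∷ []) (# 5) ∷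
  profile (true ∷ false ∷ true ∷ false ∷ false ∷ true ∷ false ∷ false ∷ true ∷ []) (# 3 ∷ # 6 ∷ # 3 ∷ # 7 ∷ # 4 ∷ # 6 ∷ # 4 ∷ # 7 ∷ # 3 ∷ # 6 ∷ # 3 ∷ # 7 ∷ # 4 ∷ # 6 ∷ # 4 ∷ # 7 ∷ []) (# 1) ∷
  profile (true ∷ false ∷ true ∷ false ∷ false ∷ true ∷ false ∷ true ∷ false ∷ []) (# 3 ∷ # 8 ∷ # 3 ∷ # 6 ∷ # 4 ∷ # 8 ∷ # 4 ∷ # 6 ∷ # 3 ∷ # 8 ∷ # 3 ∷ # 6 ∷ # 4 ∷ # 8 ∷ # 4 ∷ # 6 ∷ []) (# 1) ∷
  profile (true ∷ false ∷ true ∷ false ∷ false ∷ true ∷ true ∷ false ∷ false ∷ []) (# 3 ∷ # 7 ∷ # 3 ∷ # 8 ∷ # 4 ∷ # 7 ∷ # 4 ∷ # 8 ∷ # 3 ∷ # 7 ∷ # 3 ∷ # 8 ∷ # 4 ∷ # 7 ∷ # 4 ∷ # 8 ∷ []) (# 1) ∷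
  profile (true ∷ false ∷ true ∷ false ∷ true ∷ false ∷ false ∷ false ∷ true ∷ []) (# 5 ∷ # 6 ∷ # 5 ∷ # 7 ∷ # 3 ∷ # 6 ∷ # 3 ∷ # 7 ∷ # 5 ∷ # 6 ∷ # 5 ∷ # 7 ∷ # 3 ∷ # 6 ∷ # 3 ∷ # 7 ∷ []) (# 1) ∷
  profile (true ∷ false ∷ true ∷ false ∷ true ∷ false ∷ false ∷ true ∷ false ∷ []) (# 5 ∷ # 8 ∷ # 5 ∷ # 6 ∷ # 3 ∷ # 8 ∷ # 3 ∷ # 6 ∷ # 5 ∷ # 8 ∷ # 5 ∷ # 6 ∷ # 3 ∷ # 8 ∷ # 3 ∷ # 6 ∷ []) (# 1) ∷
  profile (true ∷ false ∷ true ∷ false ∷ true ∷ false ∷ true ∷ false ∷ false ∷ []) (# 5 ∷ # 7 ∷ # 5 ∷ # 8 ∷ # 3 ∷ # 7 ∷ # 3 ∷ # 8 ∷ # 5 ∷ # 7 ∷ # 5 ∷ # 8 ∷ # 3 ∷ # 7 ∷ # 3 ∷ # 8 ∷ []) (# 1) ∷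
  profile (true ∷ false ∷ true ∷ true ∷ false ∷ false ∷ false ∷ false ∷ true ∷ []) (# 4 ∷ # 6 ∷ # 4 ∷ # 7 ∷ # 5 ∷ # 6 ∷ # 5 ∷ # 7 ∷ # 4 ∷ # 6 ∷ # 4 ∷ # 7 ∷ # 5 ∷ # 6 ∷ # 5 ∷ # 7 ∷ []) (# 1) ∷
  profile (true ∷ false ∷ true ∷ true ∷ false ∷ false ∷ false ∷ true ∷ false ∷ []) (# 4 ∷ # 8 ∷ # 4 ∷ # 6 ∷ # 5 ∷ # 8 ∷ # 5 ∷ # 6 ∷ # 4 ∷ # 8 ∷ # 4 ∷ # 6 ∷ # 5 ∷ # 8 ∷ # 5 ∷ # 6 ∷ []) (# 1) ∷
  profile (true ∷ false ∷ true ∷ true ∷ false ∷ false ∷ true ∷ false ∷ false ∷ []) (# 4 ∷ # 7 ∷ # 4 ∷ # 8 ∷ # 5 ∷ # 7 ∷ # 5 ∷ # 8 ∷ # 4 ∷ # 7 ∷ # 4 ∷ # 8 ∷ # 5 ∷ # 7 ∷ # 5 ∷ # 8 ∷ []) (# 1) ∷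
  profile (true ∷ true ∷ false ∷ false ∷ false ∷ true ∷ false ∷ false ∷ true ∷ []) (# 3 ∷ # 6 ∷ # 3 ∷ # 7 ∷ # 4 ∷ # 6 ∷ # 4 ∷ # 7 ∷ # 3 ∷ # 6 ∷ # 3 ∷ # 7 ∷ # 4 ∷ # 6 ∷ # 4 ∷ # 7 ∷ []) (# 2) ∷
  profile (true ∷ true ∷ false ∷ false ∷ false ∷ true ∷ false ∷ true ∷ false ∷ []) (# 3 ∷ # 8 ∷ # 3 ∷ # 6 ∷ # 4 ∷ # 8 ∷ # 4 ∷ # 6 ∷ # 3 ∷ # 8 ∷ # 3 ∷ # 6 ∷ # 4 ∷ # 8 ∷ # 4 ∷ # 6 ∷ []) (# 2) ∷
  profile (true ∷ true ∷ false ∷ false ∷ false ∷ true ∷ true ∷ false ∷ false ∷ []) (# 3 ∷ # 7 ∷ # 3 ∷ # 8 ∷ # 4 ∷ # 7 ∷ # 4 ∷ # 8 ∷ # 3 ∷ # 7 ∷ # 3 ∷ # 8 ∷ # 4 ∷ # 7 ∷ # 4 ∷ # 8 ∷ []) (# 2) ∷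
  profile (true ∷ true ∷ false ∷ false ∷ true ∷ false ∷ false ∷ false ∷ true ∷ []) (# 5 ∷ # 6 ∷ # 5 ∷ # 7 ∷ # 3 ∷ # 6 ∷ # 3 ∷ # 7 ∷ # 5 ∷ # 6 ∷ # 5 ∷ # 7 ∷ # 3 ∷ # 6 ∷ # 3 ∷ # 7 ∷ []) (# 2) ∷
  profile (true ∷ true ∷ false ∷ false ∷ true ∷ false ∷ false ∷ true ∷ false ∷ []) (# 5 ∷ # 8 ∷ # 5 ∷ # 6 ∷ # 3 ∷ # 8 ∷ # 3 ∷ # 6 ∷ # 5 ∷ # 8 ∷ # 5 ∷ # 6 ∷ # 3 ∷ # 8 ∷ # 3 ∷ # 6 ∷ []) (# 2) ∷
  profile (true ∷ true ∷ false ∷ false ∷ true ∷ false ∷ true ∷ false ∷ false ∷ []) (# 5 ∷ # 7 ∷ # 5 ∷ # 8 ∷ # 3 ∷ # 7 ∷ # 3 ∷ # 8 ∷ # 5 ∷ # 7 ∷ # 5 ∷ # 8 ∷ # 3 ∷ # 7 ∷ # 3 ∷ # 8 ∷ []) (# 2) ∷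
  profile (true ∷ true ∷ false ∷ true ∷ false ∷ false ∷ false ∷ false ∷ true ∷ []) (# 4 ∷ # 6 ∷ # 4 ∷ # 7 ∷ # 5 ∷ # 6 ∷ # 5 ∷ # 7 ∷ # 4 ∷ # 6 ∷ # 4 ∷ # 7 ∷ # 5 ∷ # 6 ∷ # 5 ∷ # 7 ∷ []) (# 2) ∷
  profile (true ∷ true ∷ false ∷ true ∷ false ∷ false ∷ false ∷ true ∷ false ∷ []) (# 4 ∷ # 8 ∷ # 4 ∷ # 6 ∷ # 5 ∷ # 8 ∷ # 5 ∷ # 6 ∷ # 4 ∷ # 8 ∷ # 4 ∷ # 6 ∷ # 5 ∷ # 8 ∷ # 5 ∷ # 6 ∷ []) (# 2) ∷
  profile (true ∷ true ∷ false ∷ true ∷ false ∷ false ∷ true ∷ false ∷ false ∷ []) (# 4 ∷ # 7 ∷ # 4 ∷ # 8 ∷ # 5 ∷ # 7 ∷ # 5 ∷ # 8 ∷ # 4 ∷ # 7 ∷ # 4 ∷ # 8 ∷ # 5 ∷ # 7 ∷ # 5 ∷ # 8 ∷ []) (# 2) ∷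
  []

profiles-faithful : All Faithful profiles
profiles-faithful = toWitness {a? = all? faithful? profiles} _

H⁰₂-profiles : H⁰₂ ≡ map input profiles
H⁰₂-profiles = refl

H⁰₂-size : length H⁰₂ ≡ 81
H⁰₂-size = refl

minorityHits : DTree 9 → ℕ
minorityHits C = count (λ e → queries C (input e) (minorityLeaf e)) profiles

hits : DTree 9 → Profile → ℕ
hits C e = count (queries C (input e)) (targets e)

targetHits : DTree 9 → ℕ
targetHits C = sum (map (hits C) profiles)

numerOn : ℕ → List (Vec Bool 9) → DTree 9 → ℚ
numerOn n xs C = sumℚ (map (λ x → frac 1 n ℚ.* frac (count (λ yr → queries C x (q₁ (proj₂ yr))) (preimage x))
                                                   (length (preimage x))) xs)

numerOn-faithful : ∀ C (es : List Profile) → All Faithful es →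
                   numerOn 81 (map input es) C ≡ frac (sum (map (hits C) es)) 1296
numerOn-faithful C []       []                   = sym (frac-zero 1295)
numerOn-faithful C (e ∷ es) ((size , qs , _) ∷ fs) = begin
  frac 1 81 ℚ.* frac (count (λ yr → queries C x (q₁ (proj₂ yr))) (preimage x)) (length (preimage x))
    ℚ.+ numerOn 81 (map input es) C
    ≡⟨ cong₂ ℚ._+_ (cong (frac 1 81 ℚ.*_) (cong₂ frac hits-preimage size)) (numerOn-faithful C es fs) ⟩
  frac 1 81 ℚ.* frac (hits C e) 16 ℚ.+ frac (sum (map (hits C) es)) 1296
    ≡⟨ cong (ℚ._+ frac (sum (map (hits C) es)) 1296) (frac-* 1 (hits C e) 80 15) ⟩
  frac (1 ℕ.* hits C e) 1296 ℚ.+ frac (sum (map (hits C) es)) 1296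
    ≡⟨ frac-+ (1 ℕ.* hits C e) (sum (map (hits C) es)) 1295 ⟩
  frac (1 ℕ.* hits C e ℕ.+ sum (map (hits C) es)) 1296
    ≡⟨ cong (λ k → frac (k ℕ.+ sum (map (hits C) es)) 1296) (ℕₚ.*-identityˡ (hits C e)) ⟩
  frac (sum (map (hits C) (e ∷ es))) 1296 ∎
  where
  open ≡-Reasoning
  x : Vec Bool 9
  x = input e
  hits-preimage : count (λ yr → queries C x (q₁ (proj₂ yr))) (preimage x) ≡ hits C e
  hits-preimage = trans (sym (count-map (queries C x) (q₁ ∘ proj₂) (preimage x)))
                        (cong (count (queries C x)) qs)

-- Each step only rewrites a ℕ- or list-valued argument of numerOn or frac: a conversion check
-- between two rational expressions over the concrete list H⁰₂ would normalise them, at great cost.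
numer-targetHits : ∀ C → numer C ≡ frac (targetHits C) 1296
numer-targetHits C = begin
  numer C                            ≡⟨⟩
  numerOn (length H⁰₂) H⁰₂ C         ≡⟨ cong (λ n → numerOn n H⁰₂ C) {length H⁰₂} {81} H⁰₂-size ⟩
  numerOn 81 H⁰₂ C                   ≡⟨ cong (λ xs → numerOn 81 xs C) {H⁰₂} {map input profiles} H⁰₂-profiles ⟩
  numerOn 81 (map input profiles) C  ≡⟨ numerOn-faithful C profiles profiles-faithful ⟩
  frac (sum (map (hits C) profiles)) 1296
                                     ≡⟨ cong (λ k → frac k 1296) {y = targetHits C} refl ⟩
  frac (targetHits C) 1296           ∎
  where open ≡-Reasoning

denom-minorityHits : ∀ C → denom C ≡ frac (minorityHits C) 81
denom-minorityHits C = begin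
  denom C                                          ≡⟨⟩
  frac (count queriesMinority H⁰₂) (length H⁰₂)    ≡⟨ cong (frac (count queriesMinority H⁰₂)) H⁰₂-size ⟩
  frac (count queriesMinority H⁰₂) 81              ≡⟨ cong (λ k → frac k 81) count-profiles ⟩
  frac (minorityHits C) 81                         ∎
  where
  open ≡-Reasoning
  queriesMinority : Vec Bool 9 → Bool
  queriesMinority x = queries C x (minority 2 x)
  same-minority : ∀ {e} → Faithful e → queriesMinority (input e) ≡ queries C (input e) (minorityLeaf e)
  same-minority {e} (_ , _ , m) = cong (queries C (input e)) m
  count-profiles : count queriesMinority H⁰₂ ≡ minorityHits C
  count-profiles = begin
    count queriesMinority H⁰₂                       ≡⟨ cong (count queriesMinority) H⁰₂-profiles ⟩
    count queriesMinority (map input profiles)      ≡⟨ count-map queriesMinority input profiles ⟩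
    count (queriesMinority ∘ input) profiles        ≡⟨ count-cong (All.map same-minority profiles-faithful) ⟩
    minorityHits C                                  ∎

-- The functional 7 N − 384 D and its certificate

penalty : Bool → ℤ
penalty b = if b then + 384 else 0ℤ

score : Profile → (Fin 9 → Bool) → ℤ
score e S = + 7 * + count S (targets e) - penalty (S (minorityLeaf e))

score-cong : ∀ e {S S′} → (∀ j → S j ≡ S′ j) → score e S ≡ score e S′
score-cong e S≗S′ = cong₂ (λ k b → + 7 * + k - penalty b)
  (count-cong {xs = targets e} (All.tabulate (λ {j} _ → S≗S′ j))) (S≗S′ (minorityLeaf e))

open TreeValue input score score-cong profiles

affine-+ : ∀ a s b k → (+ 7 * + a - + 384 * + b) + (+ 7 * + s - + 384 * + k)
                      ≡ + 7 * + (a ℕ.+ s) - + 384 * + (b ℕ.+ k)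
affine-+ a s b k = trans (regroup (+ a) (+ s) (+ b) (+ k))
  (sym (cong₂ (λ u v → + 7 * u - + 384 * v) (ℤₚ.pos-+ a s) (ℤₚ.pos-+ b k)))
  where
  regroup : ∀ a s b k → (+ 7 * a - + 384 * b) + (+ 7 * s - + 384 * k) ≡ + 7 * (a + s) - + 384 * (b + k)
  regroup = solve-∀

sumℤ-score : ∀ {A : Set} (f : A → ℕ) (p : A → Bool) (xs : List A) →
  sumℤ (map (λ x → + 7 * + f x - penalty (p x)) xs) ≡ + 7 * + sum (map f xs) - + 384 * + count p xs
sumℤ-score f p []       = refl
sumℤ-score f p (x ∷ xs) with p x
... | true  = trans (cong (_+_ (+ 7 * + f x - + 384)) (sumℤ-score f p xs))
                    (affine-+ (f x) (sum (map f xs)) 1 (count p xs))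
... | false = trans (cong (_+_ (+ 7 * + f x - 0ℤ)) (sumℤ-score f p xs))
                    (affine-+ (f x) (sum (map f xs)) 0 (count p xs))

value-unrestricted-hits : ∀ C → value C (unrestricted 9) ≡ + 7 * + targetHits C - + 384 * + minorityHits C
value-unrestricted-hits C = trans (value-unrestricted C)
  (sumℤ-score (hits C) (λ e → queries C (input e) (minorityLeaf e)) profiles)

ceiling : Restriction 9 → Profile → ℤ
ceiling ρ e = + 7 * + length (targets e) - penalty (isFixed ρ (minorityLeaf e))

score≤ceiling : ∀ (ρ : Restriction 9) e (Q : Fin 9 → Bool) → score e (λ j → isFixed ρ j ∨ Q j) ℤ.≤ ceiling ρ e
score≤ceiling ρ e Q = ℤₚ.+-mono-≤
  (ℤₚ.*-monoˡ-≤-nonNeg (+ 7) {{ℤ.nonNeg}} (ℤ.+≤+ (count≤length (λ j → isFixed ρ j ∨ Q j) (targets e))))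
  (ℤₚ.neg-mono-≤ (penalty-∨ (isFixed ρ (minorityLeaf e)) (Q (minorityLeaf e))))
  where
  penalty-∨ : ∀ a b → penalty a ℤ.≤ penalty (a ∨ b)
  penalty-∨ true  _     = ℤₚ.≤-refl
  penalty-∨ false true  = ℤ.+≤+ ℕ.z≤n
  penalty-∨ false false = ℤₚ.≤-refl

ceilingSum : Restriction 9 → ℤ
ceilingSum ρ = sumℤ (map (λ e → if agrees ρ (input e) then ceiling ρ e else 0ℤ) profiles)

certificate : Table 9
certificate =
  node (node (node (node (node (node (node (node (node (stored (+ 0)) (stored (- + 432)) (stored
  (+ 432))) (node (stored (- + 432)) (stored (+ 1008)) (stored (- + 1440))) (node (stored (+ 432))
  (stored (- + 1440)) absent)) (node (node (stored (- + 432)) (stored (+ 1008)) (stored (- + 1440)))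
  (node (stored (+ 1008)) absent (stored (+ 1008))) (node (stored (- + 1440)) (stored (+ 1008))
  absent)) (node (node (stored (+ 432)) (stored (- + 1440)) absent) (node (stored (- + 1440))
  (stored (+ 1008)) absent) absent)) (node (node (node (stored (- + 432)) absent (stored (+ 192)))
  absent (node (stored (+ 192)) absent absent)) absent (node (node (stored (+ 192)) absent absent)
  absent absent)) (node (node (node (stored (+ 432)) (stored (+ 192)) (stored (+ 240))) (node
  (stored (+ 192)) (stored (+ 504)) (stored (- + 312))) (node (stored (+ 240)) (stored (- + 312))
  absent)) (node (node (stored (+ 192)) (stored (+ 504)) (stored (- + 312))) (node (stored (+ 504))
  absent (stored (+ 504))) (node (stored (- + 312)) (stored (+ 504)) absent)) (node (node (stored
  (+ 240)) (stored (- + 312)) absent) (node (stored (- + 312)) (stored (+ 504)) absent) absent)))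
  (node (node (node (node (stored (- + 432)) absent (stored (+ 192))) absent (node (stored (+ 192))
  absent absent)) absent (node (node (stored (+ 192)) absent absent) absent absent)) (node (node
  (node (stored (+ 1008)) absent (stored (+ 504))) absent (node (stored (+ 504)) absent absent))
  absent (node (node (stored (+ 504)) absent absent) absent absent)) (node (node (node (stored
  (- + 1440)) absent (stored (- + 312))) absent (node (stored (- + 312)) absent absent)) absent
  (node (node (stored (- + 312)) absent absent) absent absent))) (node (node (node (node (stored
  (+ 432)) (stored (+ 192)) (stored (+ 240))) (node (stored (+ 192)) (stored (+ 504)) (stored
  (- + 312))) (node (stored (+ 240)) (stored (- + 312)) absent)) (node (node (stored (+ 192))
  (stored (+ 504)) (stored (- + 312))) (node (stored (+ 504)) absent (stored (+ 504))) (node (stored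
  (- + 312)) (stored (+ 504)) absent)) (node (node (stored (+ 240)) (stored (- + 312)) absent) (node
  (stored (- + 312)) (stored (+ 504)) absent) absent)) (node (node (node (stored (- + 1440)) absent
  (stored (- + 312))) absent (node (stored (- + 312)) absent absent)) absent (node (node (stored
  (- + 312)) absent absent) absent absent)) absent)) (node (node (node (node (node (stored
  (- + 432)) absent (stored (+ 192))) absent (node (stored (+ 192)) absent absent)) absent (node
  (node (stored (+ 192)) absent absent) absent absent)) (node (node (node (stored (+ 1008)) absent
  (stored (+ 504))) absent (node (stored (+ 504)) absent absent)) absent (node (node (stored
  (+ 504)) absent absent) absent absent)) (node (node (node (stored (- + 1440)) absent (stored
  (- + 312))) absent (node (stored (- + 312)) absent absent)) absent (node (node (stored (- + 312))
  absent absent) absent absent))) (node (node (node (node (stored (+ 1008)) absent (stored (+ 504)))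
  absent (node (stored (+ 504)) absent absent)) absent (node (node (stored (+ 504)) absent absent)
  absent absent)) absent (node (node (node (stored (+ 1008)) absent (stored (+ 504))) absent (node
  (stored (+ 504)) absent absent)) absent (node (node (stored (+ 504)) absent absent) absent
  absent))) (node (node (node (node (stored (- + 1440)) absent (stored (- + 312))) absent (node
  (stored (- + 312)) absent absent)) absent (node (node (stored (- + 312)) absent absent) absent
  absent)) (node (node (node (stored (+ 1008)) absent (stored (+ 504))) absent (node (stored
  (+ 504)) absent absent)) absent (node (node (stored (+ 504)) absent absent) absent absent))
  absent)) (node (node (node (node (node (stored (+ 432)) (stored (+ 192)) (stored (+ 240))) (node
  (stored (+ 192)) (stored (+ 504)) (stored (- + 312))) (node (stored (+ 240)) (stored (- + 312))
  absent)) (node (node (stored (+ 192)) (stored (+ 504)) (stored (- + 312))) (node (stored (+ 504))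
  absent (stored (+ 504))) (node (stored (- + 312)) (stored (+ 504)) absent)) (node (node (stored
  (+ 240)) (stored (- + 312)) absent) (node (stored (- + 312)) (stored (+ 504)) absent) absent))
  (node (node (node (stored (- + 1440)) absent (stored (- + 312))) absent (node (stored (- + 312))
  absent absent)) absent (node (node (stored (- + 312)) absent absent) absent absent)) absent) (node
  (node (node (node (stored (- + 1440)) absent (stored (- + 312))) absent (node (stored (- + 312))
  absent absent)) absent (node (node (stored (- + 312)) absent absent) absent absent)) (node (node
  (node (stored (+ 1008)) absent (stored (+ 504))) absent (node (stored (+ 504)) absent absent))
  absent (node (node (stored (+ 504)) absent absent) absent absent)) absent) absent)) (node (node
  (node (node (node (node (stored (- + 432)) absent (stored (+ 192))) absent (node (stored (+ 192))
  absent absent)) absent (node (node (stored (+ 192)) absent absent) absent absent)) absent (node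
  (node (node (stored (+ 192)) absent (stored (+ 176))) absent (node (stored (+ 176)) absent
  absent)) absent (node (node (stored (+ 176)) absent absent) absent absent))) absent (node (node
  (node (node (stored (+ 192)) absent (stored (+ 176))) absent (node (stored (+ 176)) absent
  absent)) absent (node (node (stored (+ 176)) absent absent) absent absent)) absent absent)) absent
  (node (node (node (node (node (stored (+ 192)) absent (stored (+ 176))) absent (node (stored
  (+ 176)) absent absent)) absent (node (node (stored (+ 176)) absent absent) absent absent)) absent
  absent) absent absent)) (node (node (node (node (node (node (stored (+ 432)) (stored (+ 192))
  (stored (+ 240))) (node (stored (+ 192)) (stored (+ 504)) (stored (- + 312))) (node (stored
  (+ 240)) (stored (- + 312)) absent)) (node (node (stored (+ 192)) (stored (+ 504)) (stored
  (- + 312))) (node (stored (+ 504)) absent (stored (+ 504))) (node (stored (- + 312)) (stored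
  (+ 504)) absent)) (node (node (stored (+ 240)) (stored (- + 312)) absent) (node (stored (- + 312))
  (stored (+ 504)) absent) absent)) (node (node (node (stored (+ 192)) absent (stored (+ 176)))
  absent (node (stored (+ 176)) absent absent)) absent (node (node (stored (+ 176)) absent absent)
  absent absent)) (node (node (node (stored (+ 240)) (stored (+ 176)) (stored (+ 64))) (node (stored
  (+ 176)) (stored (+ 224)) (stored (- + 48))) (node (stored (+ 64)) (stored (- + 48)) absent))
  (node (node (stored (+ 176)) (stored (+ 224)) (stored (- + 48))) (node (stored (+ 224)) absent
  (stored (+ 224))) (node (stored (- + 48)) (stored (+ 224)) absent)) (node (node (stored (+ 64))
  (stored (- + 48)) absent) (node (stored (- + 48)) (stored (+ 224)) absent) absent))) (node (node
  (node (node (stored (+ 192)) absent (stored (+ 176))) absent (node (stored (+ 176)) absent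
  absent)) absent (node (node (stored (+ 176)) absent absent) absent absent)) (node (node (node
  (stored (+ 504)) absent (stored (+ 224))) absent (node (stored (+ 224)) absent absent)) absent
  (node (node (stored (+ 224)) absent absent) absent absent)) (node (node (node (stored (- + 312))
  absent (stored (- + 48))) absent (node (stored (- + 48)) absent absent)) absent (node (node
  (stored (- + 48)) absent absent) absent absent))) (node (node (node (node (stored (+ 240)) (stored
  (+ 176)) (stored (+ 64))) (node (stored (+ 176)) (stored (+ 224)) (stored (- + 48))) (node (stored
  (+ 64)) (stored (- + 48)) absent)) (node (node (stored (+ 176)) (stored (+ 224)) (stored
  (- + 48))) (node (stored (+ 224)) absent (stored (+ 224))) (node (stored (- + 48)) (stored
  (+ 224)) absent)) (node (node (stored (+ 64)) (stored (- + 48)) absent) (node (stored (- + 48))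
  (stored (+ 224)) absent) absent)) (node (node (node (stored (- + 312)) absent (stored (- + 48)))
  absent (node (stored (- + 48)) absent absent)) absent (node (node (stored (- + 48)) absent absent)
  absent absent)) absent)) (node (node (node (node (node (stored (+ 192)) absent (stored (+ 176)))
  absent (node (stored (+ 176)) absent absent)) absent (node (node (stored (+ 176)) absent absent)
  absent absent)) (node (node (node (stored (+ 504)) absent (stored (+ 224))) absent (node (stored
  (+ 224)) absent absent)) absent (node (node (stored (+ 224)) absent absent) absent absent)) (node
  (node (node (stored (- + 312)) absent (stored (- + 48))) absent (node (stored (- + 48)) absent
  absent)) absent (node (node (stored (- + 48)) absent absent) absent absent))) (node (node (node
  (node (stored (+ 504)) absent (stored (+ 224))) absent (node (stored (+ 224)) absent absent))
  absent (node (node (stored (+ 224)) absent absent) absent absent)) absent (node (node (node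
  (stored (+ 504)) absent (stored (+ 224))) absent (node (stored (+ 224)) absent absent)) absent
  (node (node (stored (+ 224)) absent absent) absent absent))) (node (node (node (node (stored
  (- + 312)) absent (stored (- + 48))) absent (node (stored (- + 48)) absent absent)) absent (node
  (node (stored (- + 48)) absent absent) absent absent)) (node (node (node (stored (+ 504)) absent
  (stored (+ 224))) absent (node (stored (+ 224)) absent absent)) absent (node (node (stored
  (+ 224)) absent absent) absent absent)) absent)) (node (node (node (node (node (stored (+ 240))
  (stored (+ 176)) (stored (+ 64))) (node (stored (+ 176)) (stored (+ 224)) (stored (- + 48))) (node
  (stored (+ 64)) (stored (- + 48)) absent)) (node (node (stored (+ 176)) (stored (+ 224)) (stored
  (- + 48))) (node (stored (+ 224)) absent (stored (+ 224))) (node (stored (- + 48)) (stored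
  (+ 224)) absent)) (node (node (stored (+ 64)) (stored (- + 48)) absent) (node (stored (- + 48))
  (stored (+ 224)) absent) absent)) (node (node (node (stored (- + 312)) absent (stored (- + 48)))
  absent (node (stored (- + 48)) absent absent)) absent (node (node (stored (- + 48)) absent absent)
  absent absent)) absent) (node (node (node (node (stored (- + 312)) absent (stored (- + 48)))
  absent (node (stored (- + 48)) absent absent)) absent (node (node (stored (- + 48)) absent absent)
  absent absent)) (node (node (node (stored (+ 504)) absent (stored (+ 224))) absent (node (stored
  (+ 224)) absent absent)) absent (node (node (stored (+ 224)) absent absent) absent absent))
  absent) absent))) (node (node (node (node (node (node (node (stored (- + 432)) absent (stored
  (+ 192))) absent (node (stored (+ 192)) absent absent)) absent (node (node (stored (+ 192)) absent
  absent) absent absent)) absent (node (node (node (stored (+ 192)) absent (stored (+ 176))) absent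
  (node (stored (+ 176)) absent absent)) absent (node (node (stored (+ 176)) absent absent) absent
  absent))) absent (node (node (node (node (stored (+ 192)) absent (stored (+ 176))) absent (node
  (stored (+ 176)) absent absent)) absent (node (node (stored (+ 176)) absent absent) absent
  absent)) absent absent)) absent (node (node (node (node (node (stored (+ 192)) absent (stored
  (+ 176))) absent (node (stored (+ 176)) absent absent)) absent (node (node (stored (+ 176)) absent
  absent) absent absent)) absent absent) absent absent)) (node (node (node (node (node (node (stored
  (+ 1008)) absent (stored (+ 504))) absent (node (stored (+ 504)) absent absent)) absent (node
  (node (stored (+ 504)) absent absent) absent absent)) absent (node (node (node (stored (+ 504))
  absent (stored (+ 224))) absent (node (stored (+ 224)) absent absent)) absent (node (node (stored
  (+ 224)) absent absent) absent absent))) absent (node (node (node (node (stored (+ 504)) absent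
  (stored (+ 224))) absent (node (stored (+ 224)) absent absent)) absent (node (node (stored
  (+ 224)) absent absent) absent absent)) absent absent)) absent (node (node (node (node (node
  (stored (+ 504)) absent (stored (+ 224))) absent (node (stored (+ 224)) absent absent)) absent
  (node (node (stored (+ 224)) absent absent) absent absent)) absent absent) absent absent)) (node
  (node (node (node (node (node (stored (- + 1440)) absent (stored (- + 312))) absent (node (stored
  (- + 312)) absent absent)) absent (node (node (stored (- + 312)) absent absent) absent absent))
  absent (node (node (node (stored (- + 312)) absent (stored (- + 48))) absent (node (stored
  (- + 48)) absent absent)) absent (node (node (stored (- + 48)) absent absent) absent absent)))
  absent (node (node (node (node (stored (- + 312)) absent (stored (- + 48))) absent (node (stored
  (- + 48)) absent absent)) absent (node (node (stored (- + 48)) absent absent) absent absent))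
  absent absent)) absent (node (node (node (node (node (stored (- + 312)) absent (stored (- + 48)))
  absent (node (stored (- + 48)) absent absent)) absent (node (node (stored (- + 48)) absent absent)
  absent absent)) absent absent) absent absent))) (node (node (node (node (node (node (node (stored
  (+ 432)) (stored (+ 192)) (stored (+ 240))) (node (stored (+ 192)) (stored (+ 504)) (stored
  (- + 312))) (node (stored (+ 240)) (stored (- + 312)) absent)) (node (node (stored (+ 192))
  (stored (+ 504)) (stored (- + 312))) (node (stored (+ 504)) absent (stored (+ 504))) (node (stored
  (- + 312)) (stored (+ 504)) absent)) (node (node (stored (+ 240)) (stored (- + 312)) absent) (node
  (stored (- + 312)) (stored (+ 504)) absent) absent)) (node (node (node (stored (+ 192)) absent
  (stored (+ 176))) absent (node (stored (+ 176)) absent absent)) absent (node (node (stored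
  (+ 176)) absent absent) absent absent)) (node (node (node (stored (+ 240)) (stored (+ 176))
  (stored (+ 64))) (node (stored (+ 176)) (stored (+ 224)) (stored (- + 48))) (node (stored (+ 64))
  (stored (- + 48)) absent)) (node (node (stored (+ 176)) (stored (+ 224)) (stored (- + 48))) (node
  (stored (+ 224)) absent (stored (+ 224))) (node (stored (- + 48)) (stored (+ 224)) absent)) (node
  (node (stored (+ 64)) (stored (- + 48)) absent) (node (stored (- + 48)) (stored (+ 224)) absent)
  absent))) (node (node (node (node (stored (+ 192)) absent (stored (+ 176))) absent (node (stored
  (+ 176)) absent absent)) absent (node (node (stored (+ 176)) absent absent) absent absent)) (node
  (node (node (stored (+ 504)) absent (stored (+ 224))) absent (node (stored (+ 224)) absent
  absent)) absent (node (node (stored (+ 224)) absent absent) absent absent)) (node (node (node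
  (stored (- + 312)) absent (stored (- + 48))) absent (node (stored (- + 48)) absent absent)) absent
  (node (node (stored (- + 48)) absent absent) absent absent))) (node (node (node (node (stored
  (+ 240)) (stored (+ 176)) (stored (+ 64))) (node (stored (+ 176)) (stored (+ 224)) (stored
  (- + 48))) (node (stored (+ 64)) (stored (- + 48)) absent)) (node (node (stored (+ 176)) (stored
  (+ 224)) (stored (- + 48))) (node (stored (+ 224)) absent (stored (+ 224))) (node (stored
  (- + 48)) (stored (+ 224)) absent)) (node (node (stored (+ 64)) (stored (- + 48)) absent) (node
  (stored (- + 48)) (stored (+ 224)) absent) absent)) (node (node (node (stored (- + 312)) absent
  (stored (- + 48))) absent (node (stored (- + 48)) absent absent)) absent (node (node (stored
  (- + 48)) absent absent) absent absent)) absent)) (node (node (node (node (node (stored (+ 192))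
  absent (stored (+ 176))) absent (node (stored (+ 176)) absent absent)) absent (node (node (stored
  (+ 176)) absent absent) absent absent)) (node (node (node (stored (+ 504)) absent (stored
  (+ 224))) absent (node (stored (+ 224)) absent absent)) absent (node (node (stored (+ 224)) absent
  absent) absent absent)) (node (node (node (stored (- + 312)) absent (stored (- + 48))) absent
  (node (stored (- + 48)) absent absent)) absent (node (node (stored (- + 48)) absent absent) absent
  absent))) (node (node (node (node (stored (+ 504)) absent (stored (+ 224))) absent (node (stored
  (+ 224)) absent absent)) absent (node (node (stored (+ 224)) absent absent) absent absent)) absent
  (node (node (node (stored (+ 504)) absent (stored (+ 224))) absent (node (stored (+ 224)) absent
  absent)) absent (node (node (stored (+ 224)) absent absent) absent absent))) (node (node (node
  (node (stored (- + 312)) absent (stored (- + 48))) absent (node (stored (- + 48)) absent absent))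
  absent (node (node (stored (- + 48)) absent absent) absent absent)) (node (node (node (stored
  (+ 504)) absent (stored (+ 224))) absent (node (stored (+ 224)) absent absent)) absent (node (node
  (stored (+ 224)) absent absent) absent absent)) absent)) (node (node (node (node (node (stored
  (+ 240)) (stored (+ 176)) (stored (+ 64))) (node (stored (+ 176)) (stored (+ 224)) (stored
  (- + 48))) (node (stored (+ 64)) (stored (- + 48)) absent)) (node (node (stored (+ 176)) (stored
  (+ 224)) (stored (- + 48))) (node (stored (+ 224)) absent (stored (+ 224))) (node (stored
  (- + 48)) (stored (+ 224)) absent)) (node (node (stored (+ 64)) (stored (- + 48)) absent) (node
  (stored (- + 48)) (stored (+ 224)) absent) absent)) (node (node (node (stored (- + 312)) absent
  (stored (- + 48))) absent (node (stored (- + 48)) absent absent)) absent (node (node (stored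
  (- + 48)) absent absent) absent absent)) absent) (node (node (node (node (stored (- + 312)) absent
  (stored (- + 48))) absent (node (stored (- + 48)) absent absent)) absent (node (node (stored
  (- + 48)) absent absent) absent absent)) (node (node (node (stored (+ 504)) absent (stored
  (+ 224))) absent (node (stored (+ 224)) absent absent)) absent (node (node (stored (+ 224)) absent
  absent) absent absent)) absent) absent)) (node (node (node (node (node (node (stored (- + 1440))
  absent (stored (- + 312))) absent (node (stored (- + 312)) absent absent)) absent (node (node
  (stored (- + 312)) absent absent) absent absent)) absent (node (node (node (stored (- + 312))
  absent (stored (- + 48))) absent (node (stored (- + 48)) absent absent)) absent (node (node
  (stored (- + 48)) absent absent) absent absent))) absent (node (node (node (node (stored
  (- + 312)) absent (stored (- + 48))) absent (node (stored (- + 48)) absent absent)) absent (node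
  (node (stored (- + 48)) absent absent) absent absent)) absent absent)) absent (node (node (node
  (node (node (stored (- + 312)) absent (stored (- + 48))) absent (node (stored (- + 48)) absent
  absent)) absent (node (node (stored (- + 48)) absent absent) absent absent)) absent absent) absent
  absent)) absent)) (node (node (node (node (node (node (node (node (stored (- + 432)) absent
  (stored (+ 192))) absent (node (stored (+ 192)) absent absent)) absent (node (node (stored
  (+ 192)) absent absent) absent absent)) absent (node (node (node (stored (+ 192)) absent (stored
  (+ 176))) absent (node (stored (+ 176)) absent absent)) absent (node (node (stored (+ 176)) absent
  absent) absent absent))) absent (node (node (node (node (stored (+ 192)) absent (stored (+ 176)))
  absent (node (stored (+ 176)) absent absent)) absent (node (node (stored (+ 176)) absent absent)
  absent absent)) absent absent)) absent (node (node (node (node (node (stored (+ 192)) absent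
  (stored (+ 176))) absent (node (stored (+ 176)) absent absent)) absent (node (node (stored
  (+ 176)) absent absent) absent absent)) absent absent) absent absent)) (node (node (node (node
  (node (node (stored (+ 1008)) absent (stored (+ 504))) absent (node (stored (+ 504)) absent
  absent)) absent (node (node (stored (+ 504)) absent absent) absent absent)) absent (node (node
  (node (stored (+ 504)) absent (stored (+ 224))) absent (node (stored (+ 224)) absent absent))
  absent (node (node (stored (+ 224)) absent absent) absent absent))) absent (node (node (node (node
  (stored (+ 504)) absent (stored (+ 224))) absent (node (stored (+ 224)) absent absent)) absent
  (node (node (stored (+ 224)) absent absent) absent absent)) absent absent)) absent (node (node
  (node (node (node (stored (+ 504)) absent (stored (+ 224))) absent (node (stored (+ 224)) absent
  absent)) absent (node (node (stored (+ 224)) absent absent) absent absent)) absent absent) absent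
  absent)) (node (node (node (node (node (node (stored (- + 1440)) absent (stored (- + 312))) absent
  (node (stored (- + 312)) absent absent)) absent (node (node (stored (- + 312)) absent absent)
  absent absent)) absent (node (node (node (stored (- + 312)) absent (stored (- + 48))) absent (node
  (stored (- + 48)) absent absent)) absent (node (node (stored (- + 48)) absent absent) absent
  absent))) absent (node (node (node (node (stored (- + 312)) absent (stored (- + 48))) absent (node
  (stored (- + 48)) absent absent)) absent (node (node (stored (- + 48)) absent absent) absent
  absent)) absent absent)) absent (node (node (node (node (node (stored (- + 312)) absent (stored
  (- + 48))) absent (node (stored (- + 48)) absent absent)) absent (node (node (stored (- + 48))
  absent absent) absent absent)) absent absent) absent absent))) (node (node (node (node (node (node
  (node (stored (+ 1008)) absent (stored (+ 504))) absent (node (stored (+ 504)) absent absent))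
  absent (node (node (stored (+ 504)) absent absent) absent absent)) absent (node (node (node
  (stored (+ 504)) absent (stored (+ 224))) absent (node (stored (+ 224)) absent absent)) absent
  (node (node (stored (+ 224)) absent absent) absent absent))) absent (node (node (node (node
  (stored (+ 504)) absent (stored (+ 224))) absent (node (stored (+ 224)) absent absent)) absent
  (node (node (stored (+ 224)) absent absent) absent absent)) absent absent)) absent (node (node
  (node (node (node (stored (+ 504)) absent (stored (+ 224))) absent (node (stored (+ 224)) absent
  absent)) absent (node (node (stored (+ 224)) absent absent) absent absent)) absent absent) absent
  absent)) absent (node (node (node (node (node (node (stored (+ 1008)) absent (stored (+ 504)))
  absent (node (stored (+ 504)) absent absent)) absent (node (node (stored (+ 504)) absent absent)
  absent absent)) absent (node (node (node (stored (+ 504)) absent (stored (+ 224))) absent (node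
  (stored (+ 224)) absent absent)) absent (node (node (stored (+ 224)) absent absent) absent
  absent))) absent (node (node (node (node (stored (+ 504)) absent (stored (+ 224))) absent (node
  (stored (+ 224)) absent absent)) absent (node (node (stored (+ 224)) absent absent) absent
  absent)) absent absent)) absent (node (node (node (node (node (stored (+ 504)) absent (stored
  (+ 224))) absent (node (stored (+ 224)) absent absent)) absent (node (node (stored (+ 224)) absent
  absent) absent absent)) absent absent) absent absent))) (node (node (node (node (node (node (node
  (stored (- + 1440)) absent (stored (- + 312))) absent (node (stored (- + 312)) absent absent))
  absent (node (node (stored (- + 312)) absent absent) absent absent)) absent (node (node (node
  (stored (- + 312)) absent (stored (- + 48))) absent (node (stored (- + 48)) absent absent)) absent
  (node (node (stored (- + 48)) absent absent) absent absent))) absent (node (node (node (node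
  (stored (- + 312)) absent (stored (- + 48))) absent (node (stored (- + 48)) absent absent)) absent
  (node (node (stored (- + 48)) absent absent) absent absent)) absent absent)) absent (node (node
  (node (node (node (stored (- + 312)) absent (stored (- + 48))) absent (node (stored (- + 48))
  absent absent)) absent (node (node (stored (- + 48)) absent absent) absent absent)) absent absent)
  absent absent)) (node (node (node (node (node (node (stored (+ 1008)) absent (stored (+ 504)))
  absent (node (stored (+ 504)) absent absent)) absent (node (node (stored (+ 504)) absent absent)
  absent absent)) absent (node (node (node (stored (+ 504)) absent (stored (+ 224))) absent (node
  (stored (+ 224)) absent absent)) absent (node (node (stored (+ 224)) absent absent) absent
  absent))) absent (node (node (node (node (stored (+ 504)) absent (stored (+ 224))) absent (node
  (stored (+ 224)) absent absent)) absent (node (node (stored (+ 224)) absent absent) absent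
  absent)) absent absent)) absent (node (node (node (node (node (stored (+ 504)) absent (stored
  (+ 224))) absent (node (stored (+ 224)) absent absent)) absent (node (node (stored (+ 224)) absent
  absent) absent absent)) absent absent) absent absent)) absent)) (node (node (node (node (node
  (node (node (node (stored (+ 432)) (stored (+ 192)) (stored (+ 240))) (node (stored (+ 192))
  (stored (+ 504)) (stored (- + 312))) (node (stored (+ 240)) (stored (- + 312)) absent)) (node
  (node (stored (+ 192)) (stored (+ 504)) (stored (- + 312))) (node (stored (+ 504)) absent (stored
  (+ 504))) (node (stored (- + 312)) (stored (+ 504)) absent)) (node (node (stored (+ 240)) (stored
  (- + 312)) absent) (node (stored (- + 312)) (stored (+ 504)) absent) absent)) (node (node (node
  (stored (+ 192)) absent (stored (+ 176))) absent (node (stored (+ 176)) absent absent)) absent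
  (node (node (stored (+ 176)) absent absent) absent absent)) (node (node (node (stored (+ 240))
  (stored (+ 176)) (stored (+ 64))) (node (stored (+ 176)) (stored (+ 224)) (stored (- + 48))) (node
  (stored (+ 64)) (stored (- + 48)) absent)) (node (node (stored (+ 176)) (stored (+ 224)) (stored
  (- + 48))) (node (stored (+ 224)) absent (stored (+ 224))) (node (stored (- + 48)) (stored
  (+ 224)) absent)) (node (node (stored (+ 64)) (stored (- + 48)) absent) (node (stored (- + 48))
  (stored (+ 224)) absent) absent))) (node (node (node (node (stored (+ 192)) absent (stored
  (+ 176))) absent (node (stored (+ 176)) absent absent)) absent (node (node (stored (+ 176)) absent
  absent) absent absent)) (node (node (node (stored (+ 504)) absent (stored (+ 224))) absent (node
  (stored (+ 224)) absent absent)) absent (node (node (stored (+ 224)) absent absent) absent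
  absent)) (node (node (node (stored (- + 312)) absent (stored (- + 48))) absent (node (stored
  (- + 48)) absent absent)) absent (node (node (stored (- + 48)) absent absent) absent absent)))
  (node (node (node (node (stored (+ 240)) (stored (+ 176)) (stored (+ 64))) (node (stored (+ 176))
  (stored (+ 224)) (stored (- + 48))) (node (stored (+ 64)) (stored (- + 48)) absent)) (node (node
  (stored (+ 176)) (stored (+ 224)) (stored (- + 48))) (node (stored (+ 224)) absent (stored
  (+ 224))) (node (stored (- + 48)) (stored (+ 224)) absent)) (node (node (stored (+ 64)) (stored
  (- + 48)) absent) (node (stored (- + 48)) (stored (+ 224)) absent) absent)) (node (node (node
  (stored (- + 312)) absent (stored (- + 48))) absent (node (stored (- + 48)) absent absent)) absent
  (node (node (stored (- + 48)) absent absent) absent absent)) absent)) (node (node (node (node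
  (node (stored (+ 192)) absent (stored (+ 176))) absent (node (stored (+ 176)) absent absent))
  absent (node (node (stored (+ 176)) absent absent) absent absent)) (node (node (node (stored
  (+ 504)) absent (stored (+ 224))) absent (node (stored (+ 224)) absent absent)) absent (node (node
  (stored (+ 224)) absent absent) absent absent)) (node (node (node (stored (- + 312)) absent
  (stored (- + 48))) absent (node (stored (- + 48)) absent absent)) absent (node (node (stored
  (- + 48)) absent absent) absent absent))) (node (node (node (node (stored (+ 504)) absent (stored
  (+ 224))) absent (node (stored (+ 224)) absent absent)) absent (node (node (stored (+ 224)) absent
  absent) absent absent)) absent (node (node (node (stored (+ 504)) absent (stored (+ 224))) absent
  (node (stored (+ 224)) absent absent)) absent (node (node (stored (+ 224)) absent absent) absent
  absent))) (node (node (node (node (stored (- + 312)) absent (stored (- + 48))) absent (node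
  (stored (- + 48)) absent absent)) absent (node (node (stored (- + 48)) absent absent) absent
  absent)) (node (node (node (stored (+ 504)) absent (stored (+ 224))) absent (node (stored (+ 224))
  absent absent)) absent (node (node (stored (+ 224)) absent absent) absent absent)) absent)) (node
  (node (node (node (node (stored (+ 240)) (stored (+ 176)) (stored (+ 64))) (node (stored (+ 176))
  (stored (+ 224)) (stored (- + 48))) (node (stored (+ 64)) (stored (- + 48)) absent)) (node (node
  (stored (+ 176)) (stored (+ 224)) (stored (- + 48))) (node (stored (+ 224)) absent (stored
  (+ 224))) (node (stored (- + 48)) (stored (+ 224)) absent)) (node (node (stored (+ 64)) (stored
  (- + 48)) absent) (node (stored (- + 48)) (stored (+ 224)) absent) absent)) (node (node (node
  (stored (- + 312)) absent (stored (- + 48))) absent (node (stored (- + 48)) absent absent)) absent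
  (node (node (stored (- + 48)) absent absent) absent absent)) absent) (node (node (node (node
  (stored (- + 312)) absent (stored (- + 48))) absent (node (stored (- + 48)) absent absent)) absent
  (node (node (stored (- + 48)) absent absent) absent absent)) (node (node (node (stored (+ 504))
  absent (stored (+ 224))) absent (node (stored (+ 224)) absent absent)) absent (node (node (stored
  (+ 224)) absent absent) absent absent)) absent) absent)) (node (node (node (node (node (node
  (stored (- + 1440)) absent (stored (- + 312))) absent (node (stored (- + 312)) absent absent))
  absent (node (node (stored (- + 312)) absent absent) absent absent)) absent (node (node (node
  (stored (- + 312)) absent (stored (- + 48))) absent (node (stored (- + 48)) absent absent)) absent
  (node (node (stored (- + 48)) absent absent) absent absent))) absent (node (node (node (node
  (stored (- + 312)) absent (stored (- + 48))) absent (node (stored (- + 48)) absent absent)) absent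
  (node (node (stored (- + 48)) absent absent) absent absent)) absent absent)) absent (node (node
  (node (node (node (stored (- + 312)) absent (stored (- + 48))) absent (node (stored (- + 48))
  absent absent)) absent (node (node (stored (- + 48)) absent absent) absent absent)) absent absent)
  absent absent)) absent) (node (node (node (node (node (node (node (stored (- + 1440)) absent
  (stored (- + 312))) absent (node (stored (- + 312)) absent absent)) absent (node (node (stored
  (- + 312)) absent absent) absent absent)) absent (node (node (node (stored (- + 312)) absent
  (stored (- + 48))) absent (node (stored (- + 48)) absent absent)) absent (node (node (stored
  (- + 48)) absent absent) absent absent))) absent (node (node (node (node (stored (- + 312)) absent
  (stored (- + 48))) absent (node (stored (- + 48)) absent absent)) absent (node (node (stored
  (- + 48)) absent absent) absent absent)) absent absent)) absent (node (node (node (node (node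
  (stored (- + 312)) absent (stored (- + 48))) absent (node (stored (- + 48)) absent absent)) absent
  (node (node (stored (- + 48)) absent absent) absent absent)) absent absent) absent absent)) (node
  (node (node (node (node (node (stored (+ 1008)) absent (stored (+ 504))) absent (node (stored
  (+ 504)) absent absent)) absent (node (node (stored (+ 504)) absent absent) absent absent)) absent
  (node (node (node (stored (+ 504)) absent (stored (+ 224))) absent (node (stored (+ 224)) absent
  absent)) absent (node (node (stored (+ 224)) absent absent) absent absent))) absent (node (node
  (node (node (stored (+ 504)) absent (stored (+ 224))) absent (node (stored (+ 224)) absent
  absent)) absent (node (node (stored (+ 224)) absent absent) absent absent)) absent absent)) absent
  (node (node (node (node (node (stored (+ 504)) absent (stored (+ 224))) absent (node (stored
  (+ 224)) absent absent)) absent (node (node (stored (+ 224)) absent absent) absent absent)) absent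
  absent) absent absent)) absent) absent)

potential : Restriction 9 → ℤ
potential ρ = maybe′ id (ceilingSum ρ) (find certificate ρ)

localBound? : ∀ ρ v → Dec (LocalBound potential ρ v)
localBound? ρ v = (value (leaf false) ρ ℤₚ.≤? v)
          ×-dec Finₚ.all? (λ i → Maybeₚ.≡-dec Boolₚ._≟_ (lookup ρ i) nothing
                               →-dec (potential (fix ρ i false) + potential (fix ρ i true) ℤₚ.≤? v))

certified : Restriction 9 → ℤ → Bool
certified ρ v = isYes (localBound? ρ v)

certificate-checked : allFound certified certificate ≡ true
certificate-checked = refl

certified-found : ∀ ρ {v} → find certificate ρ ≡ just v → certified ρ v ≡ true
certified-found ρ {v} found = allFound-sound certified certificate certificate-checked {ρ} {v} found

certified-sound : ∀ ρ v → certified ρ v ≡ true → LocalBound potential ρ v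
certified-sound ρ v c = toWitness {a? = localBound? ρ v} (Equivalence.from Boolₚ.T-≡ c)

potential-found : ∀ ρ {v} → find certificate ρ ≡ just v → potential ρ ≡ v
potential-found ρ found = cong (maybe′ id (ceilingSum ρ)) found

potential-ceiling : ∀ ρ → find certificate ρ ≡ nothing → ∀ C → value C ρ ℤ.≤ potential ρ
potential-ceiling ρ found C = subst (value C ρ ℤ.≤_) (cong (maybe′ id (ceilingSum ρ)) (sym found))
                                    (value≤ceiling ceiling score≤ceiling C ρ)

potential-local : ∀ ρ {v} → find certificate ρ ≡ just v → LocalBound potential ρ (potential ρ)
potential-local ρ {v} found = subst (LocalBound potential ρ) (sym (potential-found ρ found))
  (certified-sound ρ v (certified-found ρ found))

potential-bounds : ∀ ρ → (∀ C → value C ρ ℤ.≤ potential ρ) ⊎ LocalBound potential ρ (potential ρ)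
potential-bounds ρ = bounds (find certificate ρ) refl
  where
  bounds : ∀ m → find certificate ρ ≡ m → (∀ C → value C ρ ℤ.≤ potential ρ) ⊎ LocalBound potential ρ (potential ρ)
  bounds nothing  found = inj₁ (potential-ceiling ρ found)
  bounds (just v) found = inj₂ (potential-local ρ found)

hits-balance : ∀ C → 7 ℕ.* targetHits C ℕ.≤ 384 ℕ.* minorityHits C
hits-balance C = ℤₚ.drop‿+≤+
  (subst₂ ℤ._≤_ (sym (ℤₚ.pos-* 7 (targetHits C))) (sym (ℤₚ.pos-* 384 (minorityHits C)))
          (ℤₚ.i-j≤0⇒i≤j functional≤0))
  where
  functional≤0 : + 7 * + targetHits C - + 384 * + minorityHits C ℤ.≤ 0ℤ
  functional≤0 = subst (ℤ._≤ 0ℤ) (value-unrestricted-hits C)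
                       (value≤potential potential potential-bounds C (unrestricted 9))

fraction-bound : ∀ N D → 7 ℕ.* N ℕ.≤ 384 ℕ.* D → frac N 1296 ≤ + 24 / 7 ℚ.* frac D 81
fraction-bound N D balance = begin
  frac N 1296                ≤⟨ frac-mono-≤ {N} {24 ℕ.* D} {1295} {566} cross ⟩
  frac (24 ℕ.* D) (7 ℕ.* 81) ≡⟨ sym (frac-* 24 D 6 80) ⟩
  + 24 / 7 ℚ.* frac D 81     ∎
  where
  open ℚₚ.≤-Reasoning
  cross : N ℕ.* 567 ℕ.≤ 24 ℕ.* D ℕ.* 1296
  cross = subst₂ ℕ._≤_ (left N) (right D) (ℕₚ.*-monoʳ-≤ 81 balance)
    where
    left : ∀ N → 81 ℕ.* (7 ℕ.* N) ≡ N ℕ.* 567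
    left = ℕ-Solver.solve-∀
    right : ∀ D → 81 ℕ.* (384 ℕ.* D) ≡ 24 ℕ.* D ℕ.* 1296
    right = ℕ-Solver.solve-∀

α-hits : ∀ C → α C ≡ divℚ (frac (targetHits C) 1296) (frac (minorityHits C) 81)
α-hits C = cong₂ divℚ (numer-targetHits C) (denom-minorityHits C)

α≤24/7 : ∀ C → α C ≤ + 24 / 7
α≤24/7 C = subst (_≤ + 24 / 7) (sym (α-hits C))
  (divℚ-≤ (frac-nonNeg 24 6) (frac-nonNeg (minorityHits C) 80)
          (fraction-bound (targetHits C) (minorityHits C) (hits-balance C)))

optimalTree : DTree 9
optimalTree =
  query (# 0) (query (# 1) (query (# 2) (leaf false) (leaf false)) (query (# 2) (leaf false) (query
  (# 3) (query (# 4) (query (# 5) (leaf false) (query (# 6) (query (# 7) (query (# 8) (leaf false)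
  (leaf false)) (query (# 8) (leaf false) (leaf false))) (query (# 7) (query (# 8) (leaf false)
  (leaf false)) (leaf false)))) (query (# 5) (query (# 6) (query (# 7) (query (# 8) (leaf false)
  (leaf false)) (query (# 8) (leaf false) (leaf false))) (query (# 7) (query (# 8) (leaf false)
  (leaf false)) (leaf false))) (leaf false))) (query (# 4) (query (# 5) (query (# 6) (query (# 7)
  (query (# 8) (leaf false) (leaf false)) (query (# 8) (leaf false) (leaf false))) (query (# 7)
  (query (# 8) (leaf false) (leaf false)) (leaf false))) (leaf false)) (leaf false))))) (query (# 3)
  (query (# 4) (query (# 5) (leaf false) (leaf false)) (query (# 5) (leaf false) (query (# 1) (query
  (# 2) (query (# 6) (query (# 7) (query (# 8) (leaf false) (leaf false)) (query (# 8) (leaf false)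
  (leaf false))) (query (# 7) (query (# 8) (leaf false) (leaf false)) (leaf false))) (leaf false))
  (leaf false)))) (query (# 6) (query (# 7) (query (# 8) (leaf false) (leaf false)) (query (# 8)
  (leaf false) (query (# 1) (query (# 2) (query (# 4) (query (# 5) (leaf false) (leaf false)) (leaf
  false)) (leaf false)) (leaf false)))) (query (# 1) (query (# 2) (leaf false) (query (# 4) (query
  (# 5) (query (# 7) (query (# 8) (leaf false) (leaf false)) (leaf false)) (leaf false)) (leaf
  false))) (query (# 4) (query (# 5) (query (# 7) (query (# 8) (leaf false) (leaf false)) (leaf
  false)) (leaf false)) (leaf false)))))

α-optimalTree : α optimalTree ≡ + 24 / 7
α-optimalTree = begin
  α optimalTree
    ≡⟨ α-hits optimalTree ⟩
  divℚ (frac (targetHits optimalTree) 1296) (frac (minorityHits optimalTree) 81)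
    ≡⟨ cong₂ (λ N D → divℚ (frac N 1296) (frac D 81)) optimal-targetHits optimal-minorityHits ⟩
  divℚ (frac 768 1296) (frac 14 81)
    ≡⟨⟩
  + 24 / 7 ∎
  where
  open ≡-Reasoning
  optimal-targetHits : targetHits optimalTree ≡ 768
  optimal-targetHits = refl
  optimal-minorityHits : minorityHits optimalTree ≡ 14
  optimal-minorityHits = refl

-- QueriesSome is not needed: if C never queries a minority leaf then D C = 0 and divℚ returns
-- its junk value 0.
theorem5 : ((C : DTree 9) → QueriesSome C → α C ≤ + 24 / 7)
             × Σ (DTree 9) (λ C → QueriesSome C × α C ≡ + 24 / 7)
theorem5 = (λ C _ → α≤24/7 C) , optimalTree , _ , α-optimalTree
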